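{- Let $m\in\mathbb{N}_{>0}$, let $V$ be a finite set with $|V|\geq m+1$, and let $\mathcal{A}$ be a matroid on $K(V)$ with set of hyperplanes $\mathcal{H}$. Then $\mathcal{A}$ is an $m$-dimensional abstract rigidity matroid if and only if: (H1) for every $H\in\mathcal{H}$, at most $m-1$ vertices of $V(H)$ have valence $|V|-1$ in the graph $(V,H)$; and (H2) for every $v\in V$ and every $A\subseteq V\setminus\{v\}$ with $|A|=m-1$, the set $\Delta_v^A:=K(\{v\}\cup A)\cup K(V\setminus\{v\})$ is a hyperplane of $\mathcal{A}$.
   Context: For a finite set $W$, $K(W)=\{uv : u,v\in W, u\neq v\}$ is the edge set of the complete graph on $W$. For $E\subseteq K(V)$, $V(E)=\{u\in V: uw\in E \text{ for some } w\}$. A hyperplane of a matroid is a maximal subset of the ground set containing no basis. For a matroid $\mathcal{A}$ on $K(V)$ with closure operator $\sigma$, a set $E\subseteq K(V)$ is rigid if $\sigma(E)=K(V(E))$. $\mathcal{A}$ is an $m$-dimensional abstract rigidity matroid if (C1) whenever $E,F\subseteq K(V)$ with $|V(E)\cap V(F)|<m$, then $\sigma(E\cup F)\subseteq K(V(E))\cup K(V(F))$; and (C2) whenever $E,F\subseteq K(V)$ are rigid with $|V(E)\cap V(F)|\geq m$, then $E\cup F$ is rigid. -}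

module Defs where

open import Data.Nat using (ℕ; _≤_; _<_; _+_)
open import Data.Bool using (Bool; true; false; _∧_; _∨_; if_then_else_)
open import Data.Product using (_×_; _,_; proj₁; proj₂)
open import Data.List using (List; length; filter; cartesianProduct; lookup)
open import Data.Bool.ListAction using (any)
open import Data.Fin using (Fin; _≟_; _<?_)
open import Data.Fin.Subset using (Subset; _⊆_; _∪_; _∩_; ⁅_⁆; ∣_∣; _∉_; _⊈_; ⊤)
open import Data.Vec using (tabulate)
import Data.Vec as Vec
open import Data.List using (allFin) renaming (lookup to lookupL)
open import Relation.Nullary using (¬_; does)
open import Relation.Binary.PropositionalEquality using (_≡_)

_∈ᵇ_ : ∀ {k} → Fin k → Subset k → Bool
i ∈ᵇ S = Vec.lookup S i

-- Vertex set V = Fin n.  The edges of K(V) are the pairs (i , j) with i < j,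
-- enumerated in a fixed list; an edge is an index into that list.
pairs : (n : ℕ) → List (Fin n × Fin n)
pairs n = filter (λ p → proj₁ p <? proj₂ p) (cartesianProduct (allFin n) (allFin n))

N : ℕ → ℕ
N n = length (pairs n)

EdgeSet : ℕ → Set
EdgeSet n = Subset (N n)

ends : ∀ n → Fin (N n) → Fin n × Fin n
ends n e = lookupL (pairs n) e

incident : ∀ n → Fin n → Fin (N n) → Bool
incident n u e = does (u ≟ proj₁ (ends n e)) ∨ does (u ≟ proj₂ (ends n e))

K : ∀ n → Subset n → EdgeSet n
K n W = tabulate (λ e → (proj₁ (ends n e) ∈ᵇ W) ∧ (proj₂ (ends n e) ∈ᵇ W))

VE : ∀ n → EdgeSet n → Subset n
VE n E = tabulate (λ u → any (λ e → (e ∈ᵇ E) ∧ incident n u e) (allFin (N n)))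

valence : ∀ n → EdgeSet n → Fin n → ℕ
valence n E u = length (filter (λ e → Data.Bool._≟_ ((e ∈ᵇ E) ∧ incident n u e) true) (allFin (N n)))
  where import Data.Bool

record Matroid (g : ℕ) : Set where
  field
    rank     : Subset g → ℕ
    rank-≤   : ∀ X → rank X ≤ ∣ X ∣
    rank-mono : ∀ X Y → X ⊆ Y → rank X ≤ rank Y
    rank-submod : ∀ X Y → rank (X ∪ Y) + rank (X ∩ Y) ≤ rank X + rank Y

module _ {g : ℕ} (M : Matroid g) where
  open Matroid M

  Independent : Subset g → Set
  Independent X = rank X ≡ ∣ X ∣

  Basis : Subset g → Set
  Basis B = Independent B × (∀ X → B ⊆ X → Independent X → X ⊆ B)

  ContainsNoBasis : Subset g → Set
  ContainsNoBasis H = ∀ B → Basis B → ¬ (B ⊆ H)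

  Hyperplane : Subset g → Set
  Hyperplane H = ContainsNoBasis H × (∀ X → H ⊆ X → X ⊈ H → ¬ ContainsNoBasis X)

  σ : Subset g → Subset g
  σ X = tabulate (λ e → does (rank (X ∪ ⁅ e ⁆) Data.Nat.≟ rank X))
    where import Data.Nat

module _ (n : ℕ) (M : Matroid (N n)) where

  Rigid : EdgeSet n → Set
  Rigid E = σ M E ≡ K n (VE n E)

  IsAbstractRigidity : ℕ → Set
  IsAbstractRigidity m =
      (∀ E F → ∣ VE n E ∩ VE n F ∣ < m → σ M (E ∪ F) ⊆ K n (VE n E) ∪ K n (VE n F))
    × (∀ E F → Rigid E → Rigid F → m ≤ ∣ VE n E ∩ VE n F ∣ → Rigid (E ∪ F))

  fullVertices : EdgeSet n → Subset n
  fullVertices H = tabulate (λ u → (u ∈ᵇ VE n H) ∧ does (valence n H u Data.Nat.≟ (n Data.Nat.∸ 1)))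
    where import Data.Nat

-- By (C1) every closure σ X lies in K(V(X)), so each K(W) is rigid and Δ_v^A is
-- closed; adding an edge vw to Δ_v^A spans everything, because K(V ∖ {v}) and
-- K({v} ∪ A ∪ {w}) share the m vertices A ∪ {w} and their union is rigid by (C2). If a
-- hyperplane H had m full vertices U, then K(U ∪ {a}) ∪ K(U ∪ {b}) ⊆ H would be rigid for
-- all a, b ∉ U, so H would contain every edge.
--
-- For a vertex z, a set B of at most m − 1 other vertices and an edge zt with
-- t ∉ B, (H2) provides a flat Δ_z^A (A ⊇ B) containing every edge avoiding z and every edge
-- from z to B, but not zt. Hence the edges from z to any m vertices can be added one at a
-- time without spanning an edge that avoids z. With (H1), which forces the edges at any m
-- vertices to span everything, this gives local spanning: an edge pt with t ∈ T is spanned by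
-- K(T) together with the edges from p to m vertices of T, and (C2) follows. Moving the vertices
-- one at a time from one side to the other, starting from a Δ, it also shows that an edge
-- from V(E) ∖ V(F) to V(F) ∖ V(E) is not spanned by K(V(E)) ∪ K(V(F)) when these share
-- fewer than m vertices, and (C1) follows.

module Submission where

open import Defs
open import Data.Bool using (Bool; true; false; _∧_)
import Data.Bool as Bool
open import Data.Bool.Properties using (∨-zeroʳ; T-≡)
open import Data.Empty using (⊥-elim)
open import Data.Fin using (Fin; zero; suc; _≟_; _<?_) renaming (_<_ to _<ᶠ_)
import Data.Fin.Properties as Finₚ
open import Data.Fin.Subset
open import Data.Fin.Subset.Properties
open import Data.List using (List; []; _∷_; allFin; filter; length; map; cartesianProduct; lookup)
open import Data.List.Membership.Propositional using (lose) renaming (_∈_ to _∈ₗ_)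
open import Data.List.Membership.Propositional.Properties
  using (∈-filter⁺; ∈-filter⁻; ∈-allFin; ∈-cartesianProduct⁺; ∈-lookup; ∈-map⁺; ∈-map⁻)
open import Data.List.Membership.Propositional.Properties.WithK using (unique∧set⇒bag)
open import Data.List.Properties using (length-tabulate; length-map; filter-complete; filter-all; filter-≐)
open import Data.List.Relation.Binary.BagAndSetEquality using (∼bag⇒↭)
open import Data.List.Relation.Binary.Permutation.Propositional.Properties using (↭-length)
open import Data.List.Relation.Unary.All using (All; []; _∷_)
import Data.List.Relation.Unary.All as All
open import Data.List.Relation.Unary.AllPairs using ([]; _∷_)
open import Data.List.Relation.Unary.Any using (here; there; satisfied)
import Data.List.Relation.Unary.Any as Any
open import Data.List.Relation.Unary.Any.Properties using (lookup-index; any⁺; any⁻)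
open import Data.List.Relation.Unary.Unique.Propositional using (Unique)
import Data.List.Relation.Unary.Unique.Propositional.Properties as Uniqueₚ
open import Data.Nat using (ℕ; zero; suc; _≤_; _<_; _+_; _∸_; z≤n; s≤s; _≤?_) renaming (_≟_ to _≟ℕ_)
open import Data.Nat.Properties hiding (_≟_; _<?_)
open import Data.Product using (∃; _×_; _,_; _,′_; proj₁; proj₂)
open import Data.Sum using (_⊎_; inj₁; inj₂; [_,_]′; map₂; swap)
open import Data.Vec using ([]; _∷_; here; there; tabulate)
open import Data.Vec.Properties using (lookup∘tabulate; []=⇒lookup; lookup⇒[]=)
open import Function using (_∘_; id; case_of_)
open import Function.Bundles using (Equivalence; _⇔_; mk⇔)
open import Relation.Binary using (tri<; tri≈; tri>)
open import Relation.Binary.PropositionalEquality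
open import Relation.Nullary using (¬_; ¬?; Dec; yes; no; does)
open import Relation.Nullary.Decidable using (decidable-stable; dec-true; _×-dec_; _⊎-dec_)

private
  variable

    n : ℕ
    x y : Fin n
    p q r p′ q′ : Subset n

∈-∪⁺ˡ : x ∈ p → x ∈ p ∪ q
∈-∪⁺ˡ x∈p = x∈p∪q⁺ (inj₁ x∈p)

∈-∪⁺ʳ : x ∈ q → x ∈ p ∪ q
∈-∪⁺ʳ x∈q = x∈p∪q⁺ (inj₂ x∈q)

∈-∪⁻ : x ∈ p ∪ q → x ∈ p ⊎ x ∈ q
∈-∪⁻ {p = p} {q} = x∈p∪q⁻ p q

∪-least : p ⊆ r → q ⊆ r → p ∪ q ⊆ r
∪-least p⊆r q⊆r = [ p⊆r , q⊆r ]′ ∘ ∈-∪⁻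

∪-mono : p ⊆ p′ → q ⊆ q′ → p ∪ q ⊆ p′ ∪ q′
∪-mono p⊆p′ q⊆q′ = ∪-least (∈-∪⁺ˡ ∘ p⊆p′) (∈-∪⁺ʳ ∘ q⊆q′)

∈-insert⁻ : x ∈ p ∪ ⁅ y ⁆ → x ∈ p ⊎ x ≡ y
∈-insert⁻ {y = y} = map₂ (x∈⁅y⁆⇒x≡y y) ∘ ∈-∪⁻

∈-insert⁺ : y ∈ p ∪ ⁅ y ⁆
∈-insert⁺ {y = y} = ∈-∪⁺ʳ (x∈⁅x⁆ y)

⁅x⁆⊆p : x ∈ p → ⁅ x ⁆ ⊆ p
⁅x⁆⊆p {x = x} {p = p} x∈p y∈⁅x⁆ = subst (_∈ p) (sym (x∈⁅y⁆⇒x≡y x y∈⁅x⁆)) x∈p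

insert-absorb : x ∈ p → p ∪ ⁅ x ⁆ ≡ p
insert-absorb x∈p = ⊆-antisym (∪-least ⊆-refl (⁅x⁆⊆p x∈p)) ∈-∪⁺ˡ

∣insert∣ : ∀ (p : Subset n) → x ∉ p → ∣ p ∪ ⁅ x ⁆ ∣ ≡ suc ∣ p ∣
∣insert∣ {x = zero} (true ∷ p) x∉p = ⊥-elim (x∉p here)
∣insert∣ {x = zero} (false ∷ p) x∉p = cong suc (cong ∣_∣ (∪-identityʳ p))
∣insert∣ {x = suc x} (true ∷ p) x∉p = cong suc (∣insert∣ p (x∉p ∘ there))
∣insert∣ {x = suc x} (false ∷ p) x∉p = ∣insert∣ p (x∉p ∘ there)

∣⁅x⁆∪p∣≤ : ∀ (x : Fin n) p → ∣ ⁅ x ⁆ ∪ p ∣ ≤ suc ∣ p ∣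
∣⁅x⁆∪p∣≤ x p with x ∈? p
... | yes x∈p = ≤-trans (p⊆q⇒∣p∣≤∣q∣ (∪-least (⁅x⁆⊆p x∈p) ⊆-refl)) (n≤1+n _)
... | no x∉p = ≤-trans (p⊆q⇒∣p∣≤∣q∣ {p = ⁅ x ⁆ ∪ p} {q = p ∪ ⁅ x ⁆} (∪-least ∈-∪⁺ʳ ∈-∪⁺ˡ)) (≤-reflexive (∣insert∣ p x∉p))

∣∁⁅x,y⁆∣ : ∀ {n} {x y : Fin n} → x ≢ y → ∣ ∁ (⁅ x ⁆ ∪ ⁅ y ⁆) ∣ ≡ n ∸ 2
∣∁⁅x,y⁆∣ {n} {x} {y} x≢y = begin
  ∣ ∁ (⁅ x ⁆ ∪ ⁅ y ⁆) ∣    ≡⟨ ∣∁p∣≡n∸∣p∣ (⁅ x ⁆ ∪ ⁅ y ⁆) ⟩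
  n ∸ ∣ ⁅ x ⁆ ∪ ⁅ y ⁆ ∣    ≡⟨ cong (n ∸_) (∣insert∣ ⁅ x ⁆ (x≢y ∘ sym ∘ x∈⁅y⁆⇒x≡y x)) ⟩
  n ∸ suc ∣ ⁅ x ⁆ ∣        ≡⟨ cong (λ c → n ∸ suc c) (∣⁅x⁆∣≡1 x) ⟩
  n ∸ 2                    ∎
  where open ≡-Reasoning

⊆∧∣∣≤⇒⊇ : p ⊆ q → ∣ q ∣ ≤ ∣ p ∣ → q ⊆ p
⊆∧∣∣≤⇒⊇ {p = p} p⊆q ∣q∣≤∣p∣ {x} x∈q =
  decidable-stable (x ∈? p) λ x∉p → <⇒≱ (p⊂q⇒∣p∣<∣q∣ (p⊆q , x , x∈q , x∉p)) ∣q∣≤∣p∣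

⊈⇒∃∈∉ : ¬ (p ⊆ q) → ∃ λ x → x ∈ p × x ∉ q
⊈⇒∃∈∉ {p = p} {q} p⊈q with Finₚ.any? (λ x → x ∈? p ×-dec ¬? (x ∈? q))
... | yes witness = witness
... | no ∄ = ⊥-elim (p⊈q λ {x} x∈p → decidable-stable (x ∈? q) λ x∉q → ∄ (x , x∈p , x∉q))

∣p∣<n⇒∃∉ : ∀ (p : Subset n) → ∣ p ∣ < n → ∃ λ x → x ∉ p
∣p∣<n⇒∃∉ {n} p ∣p∣<n with Finₚ.any? (λ x → ¬? (x ∈? p))
... | yes x∉p = x∉p
... | no ∄x∉p = ⊥-elim (<⇒≱ ∣p∣<n (begin
        n         ≡⟨ ∣⊤∣≡n n ⟨
        ∣ ⊤ {n} ∣ ≤⟨ p⊆q⇒∣p∣≤∣q∣ {p = ⊤} (λ {x} _ → decidable-stable (x ∈? p) λ x∉p → ∄x∉p (x , x∉p)) ⟩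
        ∣ p ∣     ∎))
  where open ≤-Reasoning

0<∣p∣⇒∃∈ : ∀ (p : Subset n) → 0 < ∣ p ∣ → ∃ λ x → x ∈ p
0<∣p∣⇒∃∈ {n} p 0<∣p∣ with Finₚ.any? (_∈? p)
... | yes x∈p = x∈p
... | no ∄x∈p = ⊥-elim (<⇒≱ 0<∣p∣ (begin
        ∣ p ∣     ≤⟨ p⊆q⇒∣p∣≤∣q∣ {q = ⊥} (λ {x} x∈p → ⊥-elim (∄x∈p (x , x∈p))) ⟩
        ∣ ⊥ {n} ∣ ≡⟨ ∣⊥∣≡0 n ⟩
        0         ∎))
  where open ≤-Reasoning

∃≢ : 1 < n → ∀ (x : Fin n) → ∃ λ y → y ≢ x
∃≢ {n} 1<n x = let y , y∉⁅x⁆ = ∣p∣<n⇒∃∉ ⁅ x ⁆ (subst (_< n) (sym (∣⁅x⁆∣≡1 x)) 1<n) in y , x∉⁅y⁆⇒x≢y y∉⁅x⁆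

∃-⊆-between : ∀ (p q : Subset n) k → p ⊆ q → ∣ p ∣ ≤ k → k ≤ ∣ q ∣ →
              ∃ λ r → p ⊆ r × r ⊆ q × ∣ r ∣ ≡ k
∃-⊆-between [] [] zero _ _ _ = [] , (λ ()) , (λ ()) , refl
∃-⊆-between (true ∷ p) (false ∷ q) k p⊆q _ _ with () ← p⊆q here
∃-⊆-between (true ∷ p) (true ∷ q) (suc k) p⊆q (s≤s ∣p∣≤k) (s≤s k≤∣q∣) =
  let r , p⊆r , r⊆q , ∣r∣≡k = ∃-⊆-between p q k (drop-∷-⊆ p⊆q) ∣p∣≤k k≤∣q∣
  in true ∷ r , s⊆s p⊆r , s⊆s r⊆q , cong suc ∣r∣≡k
∃-⊆-between (false ∷ p) (false ∷ q) k p⊆q ∣p∣≤k k≤∣q∣ =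
  let r , p⊆r , r⊆q , ∣r∣≡k = ∃-⊆-between p q k (drop-∷-⊆ p⊆q) ∣p∣≤k k≤∣q∣
  in false ∷ r , s⊆s p⊆r , s⊆s r⊆q , ∣r∣≡k
∃-⊆-between (false ∷ p) (true ∷ q) k p⊆q ∣p∣≤k k≤1+∣q∣ with k ≤? ∣ q ∣
... | yes k≤∣q∣ =
  let r , p⊆r , r⊆q , ∣r∣≡k = ∃-⊆-between p q k (drop-∷-⊆ p⊆q) ∣p∣≤k k≤∣q∣
  in false ∷ r , s⊆s p⊆r , out⊆ r⊆q , ∣r∣≡k
... | no k≰∣q∣ = true ∷ q , out⊆ (drop-∷-⊆ p⊆q) , ⊆-refl , ≤-antisym (≰⇒> k≰∣q∣) k≤1+∣q∣

∃-⊆-of-size : ∀ (q : Subset n) k → k ≤ ∣ q ∣ → ∃ λ r → r ⊆ q × ∣ r ∣ ≡ k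
∃-⊆-of-size {n} q k k≤∣q∣ =
  let r , _ , r⊆q , ∣r∣≡k = ∃-⊆-between ⊥ q k ⊥⊆ (≤-trans (≤-reflexive (∣⊥∣≡0 n)) z≤n) k≤∣q∣ in r , r⊆q , ∣r∣≡k

∃-⊇-avoiding-pair : ∀ {n} {x y : Fin n} {p : Subset n} k → x ≢ y → x ∉ p → y ∉ p → ∣ p ∣ ≤ k → k ≤ n ∸ 2 →
                    ∃ λ q → p ⊆ q × x ∉ q × y ∉ q × ∣ q ∣ ≡ k
∃-⊇-avoiding-pair {x = x} {y} {p} k x≢y x∉p y∉p ∣p∣≤k k≤n∸2 =
  let q , p⊆q , q⊆ , ∣q∣≡k = ∃-⊆-between p (∁ (⁅ x ⁆ ∪ ⁅ y ⁆)) k p⊆ ∣p∣≤k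
                                (≤-trans k≤n∸2 (≤-reflexive (sym (∣∁⁅x,y⁆∣ x≢y))))
  in q , p⊆q , (λ x∈q → x∈∁p⇒x∉p (q⊆ x∈q) (∈-∪⁺ˡ (x∈⁅x⁆ x)))
       , (λ y∈q → x∈∁p⇒x∉p (q⊆ y∈q) ∈-insert⁺) , ∣q∣≡k
  where
    p⊆ : p ⊆ ∁ (⁅ x ⁆ ∪ ⁅ y ⁆)
    p⊆ z∈p = x∉p⇒x∈∁p ([ (λ z∈⁅x⁆ → x∉p (subst (_∈ p) (x∈⁅y⁆⇒x≡y x z∈⁅x⁆) z∈p))
                       , (λ z∈⁅y⁆ → y∉p (subst (_∈ p) (x∈⁅y⁆⇒x≡y y z∈⁅y⁆) z∈p)) ]′ ∘ ∈-∪⁻)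

toList : Subset n → List (Fin n)
toList p = filter (_∈? p) (allFin _)

∈-toList⁺ : x ∈ p → x ∈ₗ toList p
∈-toList⁺ {x = x} {p} x∈p = ∈-filter⁺ (_∈? p) (∈-allFin x) x∈p

∈-toList⁻ : x ∈ₗ toList p → x ∈ p
∈-toList⁻ {p = p} x∈ = proj₂ (∈-filter⁻ (_∈? p) {xs = allFin _} x∈)

fromList : List (Fin n) → Subset n
fromList [] = ⊥
fromList (x ∷ xs) = fromList xs ∪ ⁅ x ⁆

fromList-toList : ∀ (p : Subset n) → fromList (toList p) ≡ p
fromList-toList p = ⊆-antisym (∈-toList⁻ ∘ ∈-fromList⁻ (toList p)) (∈-fromList⁺ (toList p) ∘ ∈-toList⁺)
  where
    ∈-fromList⁻ : ∀ xs → x ∈ fromList xs → x ∈ₗ xs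
    ∈-fromList⁻ [] x∈⊥ = ⊥-elim (∉⊥ x∈⊥)
    ∈-fromList⁻ (y ∷ xs) x∈ = [ there ∘ ∈-fromList⁻ xs , here ]′ (∈-insert⁻ {p = fromList xs} x∈)
    ∈-fromList⁺ : ∀ xs → x ∈ₗ xs → x ∈ fromList xs
    ∈-fromList⁺ (y ∷ xs) (here refl) = ∈-insert⁺
    ∈-fromList⁺ (y ∷ xs) (there x∈xs) = ∈-∪⁺ˡ (∈-fromList⁺ xs x∈xs)

⊆-induction : ∀ (P : Subset n → Set) → P ⊥ → (∀ {p x} → p ∪ ⁅ x ⁆ ⊆ q → x ∉ p → P p → P (p ∪ ⁅ x ⁆)) → P q
⊆-induction {q = q} P base step = subst P (fromList-toList q) (go (toList q) (⊆-reflexive (fromList-toList q)))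
  where
    go : ∀ xs → fromList xs ⊆ q → P (fromList xs)
    go [] _ = base
    go (x ∷ xs) xs⊆q = case x ∈? fromList xs of λ where
      (yes x∈) → subst P (sym (insert-absorb x∈)) (go xs (xs⊆q ∘ ∈-∪⁺ˡ))
      (no x∉) → step xs⊆q x∉ (go xs (xs⊆q ∘ ∈-∪⁺ˡ))

∈-tabulate⁻ : ∀ {f : Fin n → Bool} → x ∈ tabulate f → f x ≡ true
∈-tabulate⁻ {x = x} {f} x∈ = trans (sym (lookup∘tabulate f x)) ([]=⇒lookup x∈)

∈-tabulate⁺ : ∀ {f : Fin n → Bool} → f x ≡ true → x ∈ tabulate f
∈-tabulate⁺ {x = x} {f} fx = lookup⇒[]= x _ (trans (lookup∘tabulate f x) fx)

∈ᵇ⇒∈ : x ∈ᵇ p ≡ true → x ∈ p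
∈ᵇ⇒∈ {x = x} {p} = lookup⇒[]= x p

∈⇒∈ᵇ : x ∈ p → x ∈ᵇ p ≡ true
∈⇒∈ᵇ = []=⇒lookup

∧-true⁻ : ∀ {a b} → a ∧ b ≡ true → a ≡ true × b ≡ true
∧-true⁻ {true} {true} _ = refl , refl

∧-true⁺ : ∀ {a b} → a ≡ true → b ≡ true → a ∧ b ≡ true
∧-true⁺ refl refl = refl

dec-true⁻ : ∀ {P : Set} (P? : Dec P) → does P? ≡ true → P
dec-true⁻ (yes p) _ = p

-- Matroids given by a rank function

module MatroidTheory {g : ℕ} (M : Matroid g) where
  open Matroid M

  fullRank : ℕ
  fullRank = rank ⊤

  rank≤fullRank : ∀ X → rank X ≤ fullRank
  rank≤fullRank X = rank-mono X ⊤ ⊆⊤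

  ∈σ⇒rank≡ : ∀ {X e} → e ∈ σ M X → rank (X ∪ ⁅ e ⁆) ≡ rank X
  ∈σ⇒rank≡ {X} {e} e∈σX = dec-true⁻ (rank (X ∪ ⁅ e ⁆) ≟ℕ rank X) (∈-tabulate⁻ e∈σX)

  rank≡⇒∈σ : ∀ {X e} → rank (X ∪ ⁅ e ⁆) ≡ rank X → e ∈ σ M X
  rank≡⇒∈σ {X} {e} eq = ∈-tabulate⁺ (dec-true (rank (X ∪ ⁅ e ⁆) ≟ℕ rank X) eq)

  rank-insert-≤ : ∀ X e → rank (X ∪ ⁅ e ⁆) ≤ suc (rank X)
  rank-insert-≤ X e = begin
    rank (X ∪ ⁅ e ⁆)                        ≤⟨ m≤m+n _ _ ⟩
    rank (X ∪ ⁅ e ⁆) + rank (X ∩ ⁅ e ⁆)     ≤⟨ rank-submod X ⁅ e ⁆ ⟩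
    rank X + rank ⁅ e ⁆                     ≤⟨ +-monoʳ-≤ (rank X) (≤-trans (rank-≤ ⁅ e ⁆) (≤-reflexive (∣⁅x⁆∣≡1 e))) ⟩
    rank X + 1                              ≡⟨ +-comm (rank X) 1 ⟩
    suc (rank X)                            ∎
    where open ≤-Reasoning

  rank-insert-≥ : ∀ X e → rank X ≤ rank (X ∪ ⁅ e ⁆)
  rank-insert-≥ X e = rank-mono _ _ ∈-∪⁺ˡ

  ∉σ⇒rank-suc : ∀ {X e} → e ∉ σ M X → rank (X ∪ ⁅ e ⁆) ≡ suc (rank X)
  ∉σ⇒rank-suc {X} {e} e∉σX =
    ≤-antisym (rank-insert-≤ X e) (≤∧≢⇒< (rank-insert-≥ X e) (e∉σX ∘ rank≡⇒∈σ ∘ sym))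

  rank-suc⇒∉σ : ∀ {X e} → rank (X ∪ ⁅ e ⁆) ≡ suc (rank X) → e ∉ σ M X
  rank-suc⇒∉σ eq e∈σX = 1+n≢n (trans (sym eq) (∈σ⇒rank≡ e∈σX))

  ⊆σ : ∀ {X} → X ⊆ σ M X
  ⊆σ e∈X = rank≡⇒∈σ (cong rank (insert-absorb e∈X))

  rank-insert-submod : ∀ {X Y} e → X ⊆ Y → rank (Y ∪ ⁅ e ⁆) + rank X ≤ rank (X ∪ ⁅ e ⁆) + rank Y
  rank-insert-submod {X} {Y} e X⊆Y = begin
    rank (Y ∪ ⁅ e ⁆) + rank X                            ≤⟨ +-mono-≤ (rank-mono _ _ Ye⊆) (rank-mono _ _ X⊆) ⟩
    rank ((X ∪ ⁅ e ⁆) ∪ Y) + rank ((X ∪ ⁅ e ⁆) ∩ Y)      ≤⟨ rank-submod (X ∪ ⁅ e ⁆) Y ⟩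
    rank (X ∪ ⁅ e ⁆) + rank Y                            ∎
    where
      open ≤-Reasoning
      Ye⊆ : Y ∪ ⁅ e ⁆ ⊆ (X ∪ ⁅ e ⁆) ∪ Y
      Ye⊆ = ∪-least ∈-∪⁺ʳ (∈-∪⁺ˡ ∘ ∈-∪⁺ʳ)
      X⊆ : X ⊆ (X ∪ ⁅ e ⁆) ∩ Y
      X⊆ x∈X = x∈p∩q⁺ (∈-∪⁺ˡ x∈X , X⊆Y x∈X)

  σ-mono : ∀ {X Y} → X ⊆ Y → σ M X ⊆ σ M Y
  σ-mono {X} {Y} X⊆Y {e} e∈σX = rank≡⇒∈σ (≤-antisym Ye≤Y (rank-insert-≥ Y e))
    where
      Ye≤Y : rank (Y ∪ ⁅ e ⁆) ≤ rank Y
      Ye≤Y = +-cancelʳ-≤ (rank X) _ _ (begin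
        rank (Y ∪ ⁅ e ⁆) + rank X     ≤⟨ rank-insert-submod e X⊆Y ⟩
        rank (X ∪ ⁅ e ⁆) + rank Y     ≡⟨ cong (_+ rank Y) (∈σ⇒rank≡ e∈σX) ⟩
        rank X + rank Y               ≡⟨ +-comm (rank X) (rank Y) ⟩
        rank Y + rank X               ∎)
        where open ≤-Reasoning

  rank-∪-spanned : ∀ {W Z} → Z ⊆ σ M W → rank (W ∪ Z) ≡ rank W
  rank-∪-spanned {W} {Z} Z⊆σW = ⊆-induction (λ Z′ → rank (W ∪ Z′) ≡ rank W) (cong rank (∪-identityʳ W))
    λ {Z′} {x} Z′x⊆Z _ IH → begin
      rank (W ∪ (Z′ ∪ ⁅ x ⁆))    ≡⟨ cong rank (sym (∪-assoc W Z′ ⁅ x ⁆)) ⟩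
      rank ((W ∪ Z′) ∪ ⁅ x ⁆)    ≡⟨ ∈σ⇒rank≡ (σ-mono ∈-∪⁺ˡ (Z⊆σW (Z′x⊆Z ∈-insert⁺))) ⟩
      rank (W ∪ Z′)              ≡⟨ IH ⟩
      rank W                     ∎
    where open ≡-Reasoning

  spanning⇒fullRank≤ : ∀ {X} → (∀ e → e ∈ σ M X) → fullRank ≤ rank X
  spanning⇒fullRank≤ {X} spanning = begin
    fullRank        ≤⟨ rank-mono _ _ ∈-∪⁺ʳ ⟩
    rank (X ∪ ⊤)    ≡⟨ rank-∪-spanned (λ {e} _ → spanning e) ⟩
    rank X          ∎
    where open ≤-Reasoning

  ⊆σ⇒σ⊆σ : ∀ {W Z} → Z ⊆ σ M W → σ M Z ⊆ σ M W
  ⊆σ⇒σ⊆σ {W} {Z} Z⊆σW {e} e∈σZ = rank≡⇒∈σ (≤-antisym We≤W (rank-insert-≥ W e))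
    where
      We≤W : rank (W ∪ ⁅ e ⁆) ≤ rank W
      We≤W = begin
        rank (W ∪ ⁅ e ⁆)          ≤⟨ rank-mono _ _ (∪-mono ∈-∪⁺ˡ ⊆-refl) ⟩
        rank ((W ∪ Z) ∪ ⁅ e ⁆)    ≡⟨ ∈σ⇒rank≡ (σ-mono ∈-∪⁺ʳ e∈σZ) ⟩
        rank (W ∪ Z)              ≡⟨ rank-∪-spanned Z⊆σW ⟩
        rank W                    ∎
        where open ≤-Reasoning

  rank-insert-comm : ∀ X e f → rank ((X ∪ ⁅ e ⁆) ∪ ⁅ f ⁆) ≡ rank ((X ∪ ⁅ f ⁆) ∪ ⁅ e ⁆)
  rank-insert-comm X e f = cong rank (⊆-antisym reorder reorder)
    where
      reorder : ∀ {a b} → (X ∪ ⁅ a ⁆) ∪ ⁅ b ⁆ ⊆ (X ∪ ⁅ b ⁆) ∪ ⁅ a ⁆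
      reorder = ∪-least (∪-least (∈-∪⁺ˡ ∘ ∈-∪⁺ˡ) ∈-∪⁺ʳ) (∈-∪⁺ˡ ∘ ∈-∪⁺ʳ)

  σ-exchange : ∀ {Z e f} → f ∈ σ M (Z ∪ ⁅ e ⁆) → f ∉ σ M Z → e ∈ σ M (Z ∪ ⁅ f ⁆)
  σ-exchange {Z} {e} {f} f∈σZe f∉σZ = rank≡⇒∈σ (≤-antisym (begin
    rank ((Z ∪ ⁅ f ⁆) ∪ ⁅ e ⁆)    ≡⟨ rank-insert-comm Z f e ⟩
    rank ((Z ∪ ⁅ e ⁆) ∪ ⁅ f ⁆)    ≡⟨ ∈σ⇒rank≡ f∈σZe ⟩
    rank (Z ∪ ⁅ e ⁆)              ≤⟨ rank-insert-≤ Z e ⟩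
    suc (rank Z)                  ≡⟨ ∉σ⇒rank-suc f∉σZ ⟨
    rank (Z ∪ ⁅ f ⁆)              ∎) (rank-insert-≥ _ e))
    where open ≤-Reasoning

  Flat : Subset g → Set
  Flat F = σ M F ⊆ F

  flat-rank-insert : ∀ {F X e} → Flat F → X ⊆ F → e ∉ F → rank (X ∪ ⁅ e ⁆) ≡ suc (rank X)
  flat-rank-insert {F} {X} {e} flat X⊆F e∉F = ≤-antisym (rank-insert-≤ X e) (+-cancelʳ-≤ (rank F) _ _ (begin
    suc (rank X) + rank F        ≡⟨ +-comm (suc (rank X)) (rank F) ⟩
    rank F + suc (rank X)        ≡⟨ +-suc (rank F) (rank X) ⟩
    suc (rank F) + rank X        ≡⟨ cong (_+ rank X) (∉σ⇒rank-suc (e∉F ∘ flat)) ⟨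
    rank (F ∪ ⁅ e ⁆) + rank X    ≤⟨ rank-insert-submod e X⊆F ⟩
    rank (X ∪ ⁅ e ⁆) + rank F    ∎))
    where open ≤-Reasoning

  flat-∉σ : ∀ {F X e} → Flat F → X ⊆ F → e ∉ F → e ∉ σ M X
  flat-∉σ flat X⊆F e∉F = rank-suc⇒∉σ (flat-rank-insert flat X⊆F e∉F)

  flat-∉σ-insert : ∀ {F X e f} → Flat F → X ⊆ F → f ∈ F → e ∉ F →
                   f ∉ σ M X → f ∉ σ M (X ∪ ⁅ e ⁆)
  flat-∉σ-insert {F} {X} {e} {f} flat X⊆F f∈F e∉F f∉σX f∈σXe = <-irrefl refl (begin-strict
    rank ((X ∪ ⁅ e ⁆) ∪ ⁅ f ⁆)    ≡⟨ ∈σ⇒rank≡ f∈σXe ⟩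
    rank (X ∪ ⁅ e ⁆)              ≤⟨ rank-insert-≤ X e ⟩
    suc (rank X)                  ≡⟨ ∉σ⇒rank-suc f∉σX ⟨
    rank (X ∪ ⁅ f ⁆)              <⟨ ≤-reflexive (sym (flat-rank-insert flat Xf⊆F e∉F)) ⟩
    rank ((X ∪ ⁅ f ⁆) ∪ ⁅ e ⁆)    ≡⟨ rank-insert-comm X e f ⟨
    rank ((X ∪ ⁅ e ⁆) ∪ ⁅ f ⁆)    ∎)
    where
      open ≤-Reasoning
      Xf⊆F : X ∪ ⁅ f ⁆ ⊆ F
      Xf⊆F = ∪-least X⊆F (⁅x⁆⊆p f∈F)

  independent-insert : ∀ {B e} → Independent M B → e ∉ σ M B → Independent M (B ∪ ⁅ e ⁆)
  independent-insert {B} indep e∉σB =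
    trans (∉σ⇒rank-suc e∉σB) (trans (cong suc indep) (sym (∣insert∣ B (e∉σB ∘ ⊆σ))))

  ∃-independent-⊆-of-same-rank : ∀ X → ∃ λ B → B ⊆ X × Independent M B × rank B ≡ rank X
  ∃-independent-⊆-of-same-rank X =
    ⊆-induction P (⊥ , ⊆-refl , ≤-antisym (rank-≤ ⊥) (≤-trans (≤-reflexive (∣⊥∣≡0 g)) z≤n) , refl) step

    where
      P : Subset g → Set
      P Y = ∃ λ B → B ⊆ Y × Independent M B × rank B ≡ rank Y
      step : ∀ {Y x} → Y ∪ ⁅ x ⁆ ⊆ X → x ∉ Y → P Y → P (Y ∪ ⁅ x ⁆)
      step {Y} {x} _ _ (B , B⊆Y , indep , rank≡) with x ∈? σ M Y
      ... | yes x∈σY = B , ∈-∪⁺ˡ ∘ B⊆Y , indep , trans rank≡ (sym (∈σ⇒rank≡ x∈σY))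
      ... | no x∉σY = B ∪ ⁅ x ⁆ , ∪-mono B⊆Y ⊆-refl , independent-insert indep x∉σB ,
                      trans (∉σ⇒rank-suc x∉σB) (trans (cong suc rank≡) (sym (∉σ⇒rank-suc x∉σY)))
        where
          x∉σB : x ∉ σ M B
          x∉σB = x∉σY ∘ σ-mono B⊆Y

  basis⇒fullRank : ∀ {B} → Basis M B → rank B ≡ fullRank
  basis⇒fullRank {B} (indep , maximal) = ≤-antisym (rank≤fullRank B) (spanning⇒fullRank≤ λ e →
    decidable-stable (e ∈? σ M B) λ e∉σB →
      e∉σB (⊆σ (maximal (B ∪ ⁅ e ⁆) ∈-∪⁺ˡ (independent-insert indep e∉σB) ∈-insert⁺)))

  independent∧fullRank⇒basis : ∀ {B} → Independent M B → rank B ≡ fullRank → Basis M B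
  independent∧fullRank⇒basis {B} indep full = indep , λ Y B⊆Y indepY → ⊆∧∣∣≤⇒⊇ B⊆Y (begin
    ∣ Y ∣       ≡⟨ indepY ⟨
    rank Y      ≤⟨ rank≤fullRank Y ⟩
    fullRank    ≡⟨ full ⟨
    rank B      ≡⟨ indep ⟩
    ∣ B ∣       ∎)
    where open ≤-Reasoning

  fullRank⇒∃basis⊆ : ∀ X → fullRank ≤ rank X → ∃ λ B → Basis M B × B ⊆ X
  fullRank⇒∃basis⊆ X full≤
    with B , B⊆X , indep , rank≡ ← ∃-independent-⊆-of-same-rank X
    = B , independent∧fullRank⇒basis indep (≤-antisym (rank≤fullRank B) (≤-trans full≤ (≤-reflexive (sym rank≡)))) , B⊆X

  containsNoBasis⇔rank< : ∀ {X} → (ContainsNoBasis M X → rank X < fullRank) × (rank X < fullRank → ContainsNoBasis M X)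
  containsNoBasis⇔rank< {X} = to , from
    where
      to : ContainsNoBasis M X → rank X < fullRank
      to noBasis = ≤∧≢⇒< (rank≤fullRank X) λ full →
        let B , basis , B⊆X = fullRank⇒∃basis⊆ X (≤-reflexive (sym full)) in noBasis B basis B⊆X
      from : rank X < fullRank → ContainsNoBasis M X
      from rank< B basis B⊆X = <⇒≱ rank< (begin
        fullRank    ≡⟨ basis⇒fullRank basis ⟨
        rank B      ≤⟨ rank-mono _ _ B⊆X ⟩
        rank X      ∎)
        where open ≤-Reasoning

  hyperplane⇒rank< : ∀ {H} → Hyperplane M H → rank H < fullRank
  hyperplane⇒rank< (noBasis , _) = proj₁ containsNoBasis⇔rank< noBasis

  hyperplane⇒flat : ∀ {H} → Hyperplane M H → Flat H
  hyperplane⇒flat {H} hyp@(noBasis , maximal) {e} e∈σH = decidable-stable (e ∈? H) λ e∉H →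
    maximal (H ∪ ⁅ e ⁆) ∈-∪⁺ˡ (λ He⊆H → e∉H (He⊆H ∈-insert⁺))
      (proj₂ containsNoBasis⇔rank< (begin-strict
        rank (H ∪ ⁅ e ⁆)    ≡⟨ ∈σ⇒rank≡ e∈σH ⟩
        rank H              <⟨ hyperplane⇒rank< hyp ⟩
        fullRank            ∎))
    where open ≤-Reasoning

  hyperplane-by-rank : ∀ {H} → rank H < fullRank → (∀ e → e ∉ H → fullRank ≤ rank (H ∪ ⁅ e ⁆)) → Hyperplane M H
  hyperplane-by-rank {H} rank< spanning = proj₂ containsNoBasis⇔rank< rank< , maximal
    where
      maximal : ∀ X → H ⊆ X → X ⊈ H → ¬ ContainsNoBasis M X
      maximal X H⊆X X⊈H noBasis with e , e∈X , e∉H ← ⊈⇒∃∈∉ X⊈H =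
        <⇒≱ (proj₁ containsNoBasis⇔rank< noBasis)
            (≤-trans (spanning e e∉H) (rank-mono _ _ (∪-least H⊆X (⁅x⁆⊆p e∈X))))

  module _ (f : Fin g) where
    private
      extend : List (Fin g) → Subset g → Subset g
      extend [] Z = Z
      extend (e ∷ es) Z with f ∈? σ M (Z ∪ ⁅ e ⁆)
      ... | yes _ = extend es Z
      ... | no _ = extend es (Z ∪ ⁅ e ⁆)

      ⊆-extend : ∀ es Z → Z ⊆ extend es Z
      ⊆-extend [] Z = ⊆-refl
      ⊆-extend (e ∷ es) Z with f ∈? σ M (Z ∪ ⁅ e ⁆)
      ... | yes _ = ⊆-extend es Z
      ... | no _ = ⊆-extend es (Z ∪ ⁅ e ⁆) ∘ ∈-∪⁺ˡ

      extend-∉σ : ∀ es Z → f ∉ σ M Z → f ∉ σ M (extend es Z)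
      extend-∉σ [] Z f∉σZ = f∉σZ
      extend-∉σ (e ∷ es) Z f∉σZ with f ∈? σ M (Z ∪ ⁅ e ⁆)
      ... | yes _ = extend-∉σ es Z f∉σZ
      ... | no f∉σZe = extend-∉σ es (Z ∪ ⁅ e ⁆) f∉σZe

      extend-saturated : ∀ es Z {e} → e ∈ₗ es → e ∈ extend es Z ⊎ f ∈ σ M (extend es Z ∪ ⁅ e ⁆)
      extend-saturated (e ∷ es) Z (here refl) with f ∈? σ M (Z ∪ ⁅ e ⁆)
      ... | yes f∈σZe = inj₂ (σ-mono (∪-mono (⊆-extend es Z) ⊆-refl) f∈σZe)
      ... | no _ = inj₁ (⊆-extend es (Z ∪ ⁅ e ⁆) ∈-insert⁺)
      extend-saturated (e′ ∷ es) Z (there e∈es) with f ∈? σ M (Z ∪ ⁅ e′ ⁆)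
      ... | yes _ = extend-saturated es Z e∈es
      ... | no _ = extend-saturated es (Z ∪ ⁅ e′ ⁆) e∈es

    -- H is built greedily, adding every element that keeps f outside the closure. Then
    -- every e outside H has f ∈ σ (H ∪ {e}), so by exchange σ (H ∪ {f}) is everything
    -- and σ (H ∪ {e}) ⊇ H ∪ {f} has full rank.

    ∉σ⇒∃hyperplane⊇ : ∀ {Y} → f ∉ σ M Y → ∃ λ H → Hyperplane M H × Y ⊆ H
    ∉σ⇒∃hyperplane⊇ {Y} f∉σY = H , hyperplane-by-rank rankH< spanning , ⊆-extend (allFin g) Y
      where
        H = extend (allFin g) Y
        f∉σH : f ∉ σ M H
        f∉σH = extend-∉σ (allFin g) Y f∉σY
        rankH< : rank H < fullRank
        rankH< = ≤-trans (≤-reflexive (sym (∉σ⇒rank-suc f∉σH))) (rank≤fullRank _)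
        saturated : ∀ e → e ∈ H ⊎ f ∈ σ M (H ∪ ⁅ e ⁆)
        saturated e = extend-saturated (allFin g) Y (∈-allFin e)
        spanning : ∀ e → e ∉ H → fullRank ≤ rank (H ∪ ⁅ e ⁆)
        spanning e e∉H with saturated e
        ... | inj₁ e∈H = ⊥-elim (e∉H e∈H)
        ... | inj₂ f∈σHe = spanning⇒fullRank≤ (⊆σ⇒σ⊆σ Hf⊆σHe ∘ x∈σHf)
          where
            Hf⊆σHe : H ∪ ⁅ f ⁆ ⊆ σ M (H ∪ ⁅ e ⁆)
            Hf⊆σHe = ∪-least (⊆σ ∘ ∈-∪⁺ˡ) (⁅x⁆⊆p f∈σHe)
            x∈σHf : ∀ x → x ∈ σ M (H ∪ ⁅ f ⁆)
            x∈σHf x with saturated x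
            ... | inj₁ x∈H = ⊆σ (∈-∪⁺ˡ x∈H)
            ... | inj₂ f∈σHx = σ-exchange f∈σHx f∉σH

lookup-injective : ∀ {A : Set} {xs : List A} → Unique xs → ∀ i j → lookup xs i ≡ lookup xs j → i ≡ j
lookup-injective {xs = x ∷ xs} _ zero zero _ = refl
lookup-injective {xs = x ∷ xs} (x∉ ∷ _) zero (suc j) eq = ⊥-elim (All.lookup x∉ (∈-lookup j) eq)
lookup-injective {xs = x ∷ xs} (x∉ ∷ _) (suc i) zero eq = ⊥-elim (All.lookup x∉ (∈-lookup i) (sym eq))
lookup-injective {xs = x ∷ xs} (_ ∷ xs!) (suc i) (suc j) eq = cong suc (lookup-injective xs! i j eq)

unique-⇔⇒length≡ : ∀ {A : Set} {xs ys : List A} → Unique xs → Unique ys →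
                   (∀ {x} → x ∈ₗ xs ⇔ x ∈ₗ ys) → length xs ≡ length ys
unique-⇔⇒length≡ xs! ys! xs⇔ys = ↭-length (∼bag⇒↭ (unique∧set⇒bag xs! ys! xs⇔ys))

Unique-map⁺ : ∀ {A B : Set} (f : A → B) {xs : List A} →
              (∀ {x y} → x ∈ₗ xs → y ∈ₗ xs → f x ≡ f y → x ≡ y) → Unique xs → Unique (map f xs)
Unique-map⁺ f {[]} _ [] = []
Unique-map⁺ f {x ∷ xs} f-inj (x∉xs ∷ xs!) = All-map-≢ x∉xs (λ y∈xs → y∈xs) ∷ Unique-map⁺ f (λ p q → f-inj (there p) (there q)) xs!
  where
    All-map-≢ : ∀ {ys} → All (x ≢_) ys → (∀ {y} → y ∈ₗ ys → y ∈ₗ xs) → All (f x ≢_) (map f ys)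
    All-map-≢ [] _ = []
    All-map-≢ (x≢y ∷ x≢ys) ys⊆xs =
      (λ fx≡fy → x≢y (f-inj (here refl) (there (ys⊆xs (here refl))) fx≡fy)) ∷ All-map-≢ x≢ys (ys⊆xs ∘ there)

filter-filter : ∀ {A : Set} {P Q : A → Set} (P? : ∀ x → Dec (P x)) (Q? : ∀ x → Dec (Q x)) xs →
                filter P? (filter Q? xs) ≡ filter (λ x → P? x ×-dec Q? x) xs
filter-filter P? Q? [] = refl
filter-filter P? Q? (x ∷ xs) with Q? x
... | yes _ with P? x
...   | yes _ = cong (x ∷_) (filter-filter P? Q? xs)
...   | no _ = filter-filter P? Q? xs
filter-filter P? Q? (x ∷ xs) | no _ with P? x
...   | yes _ = filter-filter P? Q? xs
...   | no _ = filter-filter P? Q? xs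

-- The complete graph on Fin n

module CompleteGraph (n : ℕ) where

  opaque
    end₁ end₂ : Fin (N n) → Fin n
    end₁ e = proj₁ (ends n e)
    end₂ e = proj₂ (ends n e)

  infix 4 _∈ₑ_ _∈ₑ?_

  _∈ₑ_ : Fin n → Fin (N n) → Set
  x ∈ₑ e = x ≡ end₁ e ⊎ x ≡ end₂ e

  _∈ₑ?_ : ∀ x e → Dec (x ∈ₑ e)
  x ∈ₑ? e = (x ≟ end₁ e) ⊎-dec (x ≟ end₂ e)

  end₁∈ₑ : ∀ e → end₁ e ∈ₑ e
  end₁∈ₑ e = inj₁ refl

  end₂∈ₑ : ∀ e → end₂ e ∈ₑ e
  end₂∈ₑ e = inj₂ refl

  opaque
    unfolding end₁ end₂

    end₁<end₂ : ∀ e → end₁ e <ᶠ end₂ e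
    end₁<end₂ e = proj₂ (∈-filter⁻ (λ p → proj₁ p <? proj₂ p) {xs = cartesianProduct (allFin n) (allFin n)} (∈-lookup e))

    ends-injective : ∀ {e e′} → ends n e ≡ ends n e′ → e ≡ e′
    ends-injective = lookup-injective (Uniqueₚ.filter⁺ _ (Uniqueₚ.cartesianProduct⁺ (Uniqueₚ.allFin⁺ n) (Uniqueₚ.allFin⁺ n))) _ _

    ∃edge-< : ∀ {x y} → x <ᶠ y → ∃ λ e → end₁ e ≡ x × end₂ e ≡ y
    ∃edge-< {x} {y} x<y = Any.index xy∈ , cong proj₁ (sym (lookup-index xy∈)) , cong proj₂ (sym (lookup-index xy∈))
      where
        xy∈ : (x , y) ∈ₗ pairs n
        xy∈ = ∈-filter⁺ (λ p → proj₁ p <? proj₂ p) (∈-cartesianProduct⁺ (∈-allFin x) (∈-allFin y)) x<y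

    edge-by-ends : ∀ {e e′} → end₁ e ≡ end₁ e′ → end₂ e ≡ end₂ e′ → e ≡ e′
    edge-by-ends eq₁ eq₂ = ends-injective (cong₂ _,_ eq₁ eq₂)

  end₁≢end₂ : ∀ e → end₁ e ≢ end₂ e
  end₁≢end₂ e eq = Finₚ.<-irrefl eq (end₁<end₂ e)

  ∃edge : ∀ {x y} → x ≢ y → ∃ λ e → x ∈ₑ e × y ∈ₑ e
  ∃edge {x} {y} x≢y with Finₚ.<-cmp x y
  ... | tri< x<y _ _ = let e , eq₁ , eq₂ = ∃edge-< x<y in e , inj₁ (sym eq₁) , inj₂ (sym eq₂)
  ... | tri≈ _ x≡y _ = ⊥-elim (x≢y x≡y)
  ... | tri> _ _ y<x = let e , eq₁ , eq₂ = ∃edge-< y<x in e , inj₂ (sym eq₂) , inj₁ (sym eq₁)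

  ∈ₑ-two : ∀ {e x y} → x ∈ₑ e → y ∈ₑ e → x ≢ y → ∀ {z} → z ∈ₑ e → z ≡ x ⊎ z ≡ y
  ∈ₑ-two (inj₁ refl) (inj₁ refl) x≢y _ = ⊥-elim (x≢y refl)
  ∈ₑ-two (inj₁ refl) (inj₂ refl) _ z∈e = z∈e
  ∈ₑ-two (inj₂ refl) (inj₁ refl) _ z∈e = swap z∈e
  ∈ₑ-two (inj₂ refl) (inj₂ refl) x≢y _ = ⊥-elim (x≢y refl)

  ∈ₑ-ordered : ∀ {e x y} → x <ᶠ y → x ∈ₑ e → y ∈ₑ e → end₁ e ≡ x × end₂ e ≡ y
  ∈ₑ-ordered x<y (inj₁ refl) (inj₂ refl) = refl , refl
  ∈ₑ-ordered x<y (inj₁ refl) (inj₁ refl) = ⊥-elim (Finₚ.<-irrefl refl x<y)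
  ∈ₑ-ordered x<y (inj₂ refl) (inj₂ refl) = ⊥-elim (Finₚ.<-irrefl refl x<y)
  ∈ₑ-ordered {e} x<y (inj₂ refl) (inj₁ refl) = ⊥-elim (Finₚ.<-asym x<y (end₁<end₂ e))

  edge-unique-< : ∀ {e e′ x y} → x <ᶠ y → x ∈ₑ e → y ∈ₑ e → x ∈ₑ e′ → y ∈ₑ e′ → e ≡ e′
  edge-unique-< x<y x∈e y∈e x∈e′ y∈e′ =
    let e₁≡x , e₂≡y = ∈ₑ-ordered x<y x∈e y∈e ; e′₁≡x , e′₂≡y = ∈ₑ-ordered x<y x∈e′ y∈e′
    in edge-by-ends (trans e₁≡x (sym e′₁≡x)) (trans e₂≡y (sym e′₂≡y))

  edge-unique : ∀ {e e′ x y} → x ≢ y → x ∈ₑ e → y ∈ₑ e → x ∈ₑ e′ → y ∈ₑ e′ → e ≡ e′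
  edge-unique {x = x} {y} x≢y x∈e y∈e x∈e′ y∈e′ with Finₚ.<-cmp x y
  ... | tri< x<y _ _ = edge-unique-< x<y x∈e y∈e x∈e′ y∈e′
  ... | tri≈ _ x≡y _ = ⊥-elim (x≢y x≡y)
  ... | tri> _ _ y<x = edge-unique-< y<x y∈e x∈e y∈e′ x∈e′

  opposite : Fin n → Fin (N n) → Fin n
  opposite u e with u ≟ end₁ e
  ... | yes _ = end₂ e
  ... | no _ = end₁ e

  opposite-∈ₑ : ∀ {u e} → u ∈ₑ e → opposite u e ∈ₑ e × opposite u e ≢ u
  opposite-∈ₑ {u} {e} u∈e with u ≟ end₁ e | u∈e
  ... | yes u≡₁ | _ = end₂∈ₑ e , λ ₂≡u → end₁≢end₂ e (trans (sym u≡₁) (sym ₂≡u))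
  ... | no u≢₁ | inj₁ u≡₁ = ⊥-elim (u≢₁ u≡₁)
  ... | no _ | inj₂ u≡₂ = end₁∈ₑ e , λ ₁≡u → end₁≢end₂ e (trans ₁≡u u≡₂)

  opaque
    unfolding end₁ end₂

    incident⇒∈ₑ : ∀ {u e} → incident n u e ≡ true → u ∈ₑ e
    incident⇒∈ₑ {u} {e} inc with u ≟ end₁ e | u ≟ end₂ e
    ... | yes u≡₁ | _ = inj₁ u≡₁
    ... | no _ | yes u≡₂ = inj₂ u≡₂

    ∈ₑ⇒incident : ∀ {u e} → u ∈ₑ e → incident n u e ≡ true
    ∈ₑ⇒incident {u} {e} (inj₁ u≡₁) rewrite dec-true (u ≟ end₁ e) u≡₁ = refl
    ∈ₑ⇒incident {u} {e} (inj₂ u≡₂) rewrite dec-true (u ≟ end₂ e) u≡₂ = ∨-zeroʳ _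

    ∈K⁺ : ∀ {W e} → (∀ {x} → x ∈ₑ e → x ∈ W) → e ∈ K n W
    ∈K⁺ {W} {e} ends∈W = ∈-tabulate⁺ (∧-true⁺ (∈⇒∈ᵇ (ends∈W (end₁∈ₑ e))) (∈⇒∈ᵇ (ends∈W (end₂∈ₑ e))))

    ∈K⁻ : ∀ {W e x} → e ∈ K n W → x ∈ₑ e → x ∈ W
    ∈K⁻ e∈K (inj₁ refl) = ∈ᵇ⇒∈ (proj₁ (∧-true⁻ (∈-tabulate⁻ e∈K)))
    ∈K⁻ e∈K (inj₂ refl) = ∈ᵇ⇒∈ (proj₂ (∧-true⁻ (∈-tabulate⁻ e∈K)))

    ∈VE⁺ : ∀ {E u e} → e ∈ E → u ∈ₑ e → u ∈ VE n E
    ∈VE⁺ {E} {u} {e} e∈E u∈e = ∈-tabulate⁺ (Equivalence.to T-≡ (any⁺ _ (lose (∈-allFin e)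
      (Equivalence.from T-≡ (∧-true⁺ (∈⇒∈ᵇ e∈E) (∈ₑ⇒incident u∈e))))))

    ∈VE⁻ : ∀ {E u} → u ∈ VE n E → ∃ λ e → e ∈ E × u ∈ₑ e
    ∈VE⁻ {E} {u} u∈VE
      with e , pe ← satisfied (any⁻ _ (allFin (N n)) (Equivalence.from T-≡ (∈-tabulate⁻ u∈VE)))
      with e∈E , incident≡ ← ∧-true⁻ {e ∈ᵇ E} (Equivalence.to T-≡ pe)
      = e , ∈ᵇ⇒∈ e∈E , incident⇒∈ₑ incident≡

  K-mono : ∀ {W W′} → W ⊆ W′ → K n W ⊆ K n W′
  K-mono W⊆W′ e∈K = ∈K⁺ (W⊆W′ ∘ ∈K⁻ e∈K)

  ⊆K-VE : ∀ {E} → E ⊆ K n (VE n E)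
  ⊆K-VE e∈E = ∈K⁺ (∈VE⁺ e∈E)

  VE-K⊆ : ∀ {W} → VE n (K n W) ⊆ W
  VE-K⊆ x∈VE with e , e∈K , x∈e ← ∈VE⁻ x∈VE = ∈K⁻ e∈K x∈e

  ∈K-ends : ∀ {W e x y} → x ∈ₑ e → y ∈ₑ e → x ≢ y → x ∈ W → y ∈ W → e ∈ K n W
  ∈K-ends {W} x∈e y∈e x≢y x∈W y∈W = ∈K⁺ {W} λ z∈e → [ (λ { refl → x∈W }) , (λ { refl → y∈W }) ]′ (∈ₑ-two x∈e y∈e x≢y z∈e)

  ∈VE-K⁺ : ∀ {W x y} → x ∈ W → y ∈ W → x ≢ y → x ∈ VE n (K n W)
  ∈VE-K⁺ {W} x∈W y∈W x≢y = let e , x∈e , y∈e = ∃edge x≢y in ∈VE⁺ (∈K-ends {W} x∈e y∈e x≢y x∈W y∈W) x∈e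

  VE-mono : ∀ {E F} → E ⊆ F → VE n E ⊆ VE n F
  VE-mono E⊆F x∈VE with e , e∈E , x∈e ← ∈VE⁻ x∈VE = ∈VE⁺ (E⊆F e∈E) x∈e

  VE-∪⊇ : ∀ {E F} → VE n E ∪ VE n F ⊆ VE n (E ∪ F)
  VE-∪⊇ {E} {F} = ∪-least (VE-mono {E} {E ∪ F} ∈-∪⁺ˡ) (VE-mono {F} {E ∪ F} ∈-∪⁺ʳ)

  VE-∪⊆ : ∀ {E F} → VE n (E ∪ F) ⊆ VE n E ∪ VE n F
  VE-∪⊆ {E} {F} x∈VE with e , e∈E∪F , x∈e ← ∈VE⁻ {E ∪ F} x∈VE =
    [ (λ e∈E → ∈-∪⁺ˡ (∈VE⁺ e∈E x∈e)) , (λ e∈F → ∈-∪⁺ʳ (∈VE⁺ e∈F x∈e)) ]′ (∈-∪⁻ {p = E} e∈E∪F)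

  incidentEdges : Fin n → List (Fin (N n))
  incidentEdges u = filter (u ∈ₑ?_) (allFin (N n))

  ∈incidentEdges⁻ : ∀ {u e} → e ∈ₗ incidentEdges u → u ∈ₑ e
  ∈incidentEdges⁻ {u} e∈ = proj₂ (∈-filter⁻ (u ∈ₑ?_) {xs = allFin (N n)} e∈)

  ∈incidentEdges⁺ : ∀ {u e} → u ∈ₑ e → e ∈ₗ incidentEdges u
  ∈incidentEdges⁺ {u} {e} u∈e = ∈-filter⁺ (u ∈ₑ?_) (∈-allFin e) u∈e

  -- The edges at u correspond to the other vertices, via e ↦ opposite u e.
  length-incidentEdges : ∀ u → length (incidentEdges u) ≡ n ∸ 1
  length-incidentEdges u = cong (_∸ 1) (begin
    suc (length (incidentEdges u))          ≡⟨ cong suc (length-map (opposite u) (incidentEdges u)) ⟨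
    length (u ∷ map (opposite u) (incidentEdges u))
                                            ≡⟨ unique-⇔⇒length≡ neighbourhood! (Uniqueₚ.allFin⁺ n) (mk⇔ (λ _ → ∈-allFin _) ∈neighbourhood) ⟩
    length (allFin n)                       ≡⟨ length-tabulate _ ⟩
    n                                       ∎)
    where
      open ≡-Reasoning
      neighbourhood! : Unique (u ∷ map (opposite u) (incidentEdges u))
      neighbourhood! = All.tabulate u∉map ∷ Unique-map⁺ (opposite u) opposite-injective (Uniqueₚ.filter⁺ _ (Uniqueₚ.allFin⁺ (N n)))
        where
          opposite-injective : ∀ {a b} → a ∈ₗ incidentEdges u → b ∈ₗ incidentEdges u → opposite u a ≡ opposite u b → a ≡ b
          opposite-injective {a} {b} a∈ b∈ eq =
            let w∈a , w≢u = opposite-∈ₑ (∈incidentEdges⁻ a∈) ; w∈b , _ = opposite-∈ₑ (∈incidentEdges⁻ b∈)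
            in edge-unique (w≢u ∘ sym) (∈incidentEdges⁻ a∈) w∈a (∈incidentEdges⁻ b∈) (subst (_∈ₑ b) (sym eq) w∈b)
          u∉map : ∀ {w} → w ∈ₗ map (opposite u) (incidentEdges u) → u ≢ w
          u∉map w∈ u≡w with e , e∈ , refl ← ∈-map⁻ (opposite u) w∈ = proj₂ (opposite-∈ₑ (∈incidentEdges⁻ e∈)) (sym u≡w)
      ∈neighbourhood : ∀ {x} → x ∈ₗ allFin n → x ∈ₗ u ∷ map (opposite u) (incidentEdges u)
      ∈neighbourhood {x} _ with x ≟ u
      ... | yes refl = here refl
      ... | no x≢u with e , u∈e , x∈e ← ∃edge (x≢u ∘ sym)
                    with opposite-∈ₑ u∈e | ∈ₑ-two u∈e x∈e (x≢u ∘ sym) (proj₁ (opposite-∈ₑ u∈e))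
      ...   | _ , opp≢u | inj₁ opp≡u = ⊥-elim (opp≢u opp≡u)
      ...   | _ , _ | inj₂ opp≡x = there (subst (_∈ₗ map (opposite u) (incidentEdges u)) opp≡x
                                          (∈-map⁺ (opposite u) (∈incidentEdges⁺ u∈e)))

  valence≡ : ∀ H u → valence n H u ≡ length (filter (_∈? H) (incidentEdges u))
  valence≡ H u = cong length (begin
    filter (λ e → (e ∈ᵇ H) ∧ incident n u e Bool.≟ true) (allFin (N n))
                                                      ≡⟨ filter-≐ _ _ (to , from) (allFin (N n)) ⟩
    filter (λ e → (e ∈? H) ×-dec (u ∈ₑ? e)) (allFin (N n))
                                                      ≡⟨ filter-filter (_∈? H) (u ∈ₑ?_) (allFin (N n)) ⟨
    filter (_∈? H) (incidentEdges u)                  ∎)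
    where
      open ≡-Reasoning
      to : ∀ {e} → (e ∈ᵇ H) ∧ incident n u e ≡ true → e ∈ H × u ∈ₑ e
      to ≡true = let e∈H , inc = ∧-true⁻ ≡true in ∈ᵇ⇒∈ e∈H , incident⇒∈ₑ inc
      from : ∀ {e} → e ∈ H × u ∈ₑ e → (e ∈ᵇ H) ∧ incident n u e ≡ true
      from (e∈H , u∈e) = ∧-true⁺ (∈⇒∈ᵇ e∈H) (∈ₑ⇒incident u∈e)

  valence≡n∸1⇒incident⊆ : ∀ {H u} → valence n H u ≡ n ∸ 1 → ∀ {e} → u ∈ₑ e → e ∈ H
  valence≡n∸1⇒incident⊆ {H} {u} full {e} u∈e =
    proj₂ (∈-filter⁻ (_∈? H) {xs = incidentEdges u} (subst (e ∈ₗ_) (sym all∈H) (∈incidentEdges⁺ u∈e)))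
    where
      all∈H : filter (_∈? H) (incidentEdges u) ≡ incidentEdges u
      all∈H = filter-complete (_∈? H) (trans (sym (valence≡ H u)) (trans full (sym (length-incidentEdges u))))

  incident⊆⇒valence≡n∸1 : ∀ {H u} → (∀ {e} → u ∈ₑ e → e ∈ H) → valence n H u ≡ n ∸ 1
  incident⊆⇒valence≡n∸1 {H} {u} incident⊆H = begin
    valence n H u                                   ≡⟨ valence≡ H u ⟩
    length (filter (_∈? H) (incidentEdges u))       ≡⟨ cong length (filter-all (_∈? H) (All.tabulate (incident⊆H ∘ ∈incidentEdges⁻))) ⟩
    length (incidentEdges u)                        ≡⟨ length-incidentEdges u ⟩
    n ∸ 1                                           ∎
    where open ≡-Reasoning

  module _ (M : Matroid (N n)) {H : EdgeSet n} {u : Fin n} where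

    ∈fullVertices⁻ : u ∈ fullVertices n M H → ∀ {e} → u ∈ₑ e → e ∈ H
    ∈fullVertices⁻ u∈ = valence≡n∸1⇒incident⊆ (dec-true⁻ (valence n H u ≟ℕ n ∸ 1) (proj₂ (∧-true⁻ (∈-tabulate⁻ u∈))))

    ∈fullVertices⁺ : 1 < n → (∀ {e} → u ∈ₑ e → e ∈ H) → u ∈ fullVertices n M H
    ∈fullVertices⁺ 1<n incident⊆H =
      ∈-tabulate⁺ (∧-true⁺ (∈⇒∈ᵇ u∈VE) (dec-true (valence n H u ≟ℕ n ∸ 1) (incident⊆⇒valence≡n∸1 incident⊆H)))
      where
        u∈VE : u ∈ VE n H
        u∈VE with w , w≢u ← ∃≢ 1<n u with e , u∈e , _ ← ∃edge (w≢u ∘ sym) = ∈VE⁺ (incident⊆H u∈e) u∈e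

  Δ : Fin n → Subset n → EdgeSet n
  Δ v A = K n (⁅ v ⁆ ∪ A) ∪ K n (∁ ⁅ v ⁆)

  ∈∁⁅⁆⁺ : ∀ {x y : Fin n} → x ≢ y → x ∈ ∁ ⁅ y ⁆
  ∈∁⁅⁆⁺ {y = y} x≢y = x∉p⇒x∈∁p (x≢y ∘ x∈⁅y⁆⇒x≡y y)

  ∉ₑ⇒∈K∁⁅⁆ : ∀ {v e} → ¬ v ∈ₑ e → e ∈ K n (∁ ⁅ v ⁆)
  ∉ₑ⇒∈K∁⁅⁆ {v} v∉e = ∈K⁺ {∁ ⁅ v ⁆} λ {x} x∈e → ∈∁⁅⁆⁺ λ { refl → v∉e x∈e }

  ∈K∁⁅⁆⇒∉ₑ : ∀ {v e} → e ∈ K n (∁ ⁅ v ⁆) → ¬ v ∈ₑ e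
  ∈K∁⁅⁆⇒∉ₑ {v} e∈K v∈e = x∈∁p⇒x∉p (∈K⁻ e∈K v∈e) (x∈⁅x⁆ v)

  ∉ₑ⇒∈Δ : ∀ {v A e} → ¬ v ∈ₑ e → e ∈ Δ v A
  ∉ₑ⇒∈Δ v∉e = ∈-∪⁺ʳ (∉ₑ⇒∈K∁⁅⁆ v∉e)

  ∉Δ⇒∈ₑ : ∀ {v A e} → e ∉ Δ v A → v ∈ₑ e
  ∉Δ⇒∈ₑ {v} {A} {e} e∉Δ = decidable-stable (v ∈ₑ? e) (e∉Δ ∘ ∉ₑ⇒∈Δ)

  ∈Δ⁺ : ∀ {v A e w} → v ∈ₑ e → w ∈ₑ e → w ≢ v → w ∈ A → e ∈ Δ v A
  ∈Δ⁺ {v} {A} v∈e w∈e w≢v w∈A = ∈-∪⁺ˡ (∈K-ends {⁅ v ⁆ ∪ A} v∈e w∈e (w≢v ∘ sym) (∈-∪⁺ˡ (x∈⁅x⁆ v)) (∈-∪⁺ʳ w∈A))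

  ∉Δ : ∀ {v A e w} → v ∈ₑ e → w ∈ₑ e → w ∉ ⁅ v ⁆ ∪ A → e ∉ Δ v A
  ∉Δ {v} {A} v∈e w∈e w∉ e∈Δ with ∈-∪⁻ {p = K n (⁅ v ⁆ ∪ A)} e∈Δ
  ... | inj₁ e∈K = w∉ (∈K⁻ e∈K w∈e)
  ... | inj₂ e∈K = ∈K∁⁅⁆⇒∉ₑ e∈K v∈e

  ∉K⇒∃end∉ : ∀ {W e} → e ∉ K n W → ∃ λ a → a ∈ₑ e × a ∉ W
  ∉K⇒∃end∉ {W} {e} e∉K with end₁ e ∈? W | end₂ e ∈? W
  ... | no a∉W | _ = end₁ e , end₁∈ₑ e , a∉W
  ... | yes _ | no b∉W = end₂ e , end₂∈ₑ e , b∉W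
  ... | yes a∈W | yes b∈W = ⊥-elim (e∉K (∈K⁺ {W} λ { (inj₁ refl) → a∈W ; (inj₂ refl) → b∈W }))

  -- star U consists of the edges meeting U, starAt z U of the edges joining z to U.
  star : Subset n → EdgeSet n
  star U = ∁ (K n (∁ U))

  ∈star⁺ : ∀ {U u e} → u ∈ U → u ∈ₑ e → e ∈ star U
  ∈star⁺ {U} u∈U u∈e = x∉p⇒x∈∁p λ e∈K → x∈∁p⇒x∉p (∈K⁻ {∁ U} e∈K u∈e) u∈U

  ∈star⁻ : ∀ {U e} → e ∈ star U → ∃ λ u → u ∈ U × u ∈ₑ e
  ∈star⁻ {U} e∈ with u , u∈e , u∉∁U ← ∉K⇒∃end∉ {∁ U} (x∈∁p⇒x∉p e∈) = u , x∉∁p⇒x∈p u∉∁U , u∈e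

  starAt : Fin n → Subset n → EdgeSet n
  starAt z U = K n (⁅ z ⁆ ∪ U) ∩ star ⁅ z ⁆

  ∈starAt⁺ : ∀ {z U u e} → z ∈ₑ e → u ∈ U → u ∈ₑ e → u ≢ z → e ∈ starAt z U
  ∈starAt⁺ {z} {U} z∈e u∈U u∈e u≢z =
    x∈p∩q⁺ (∈K-ends {⁅ z ⁆ ∪ U} z∈e u∈e (u≢z ∘ sym) (∈-∪⁺ˡ (x∈⁅x⁆ z)) (∈-∪⁺ʳ u∈U) , ∈star⁺ (x∈⁅x⁆ z) z∈e)

  starAt⊆K : ∀ {z U} → starAt z U ⊆ K n (⁅ z ⁆ ∪ U)
  starAt⊆K {z} {U} = proj₁ ∘ x∈p∩q⁻ (K n (⁅ z ⁆ ∪ U)) _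

  ∈starAt⁻ : ∀ {z U e} → e ∈ starAt z U → z ∈ₑ e × ∀ {x} → x ∈ₑ e → x ≢ z → x ∈ U
  ∈starAt⁻ {z} {U} {e} e∈ = z∈e , other∈U
    where
      z∈e : z ∈ₑ e
      z∈e = decidable-stable (z ∈ₑ? e) λ z∉e →
        x∈∁p⇒x∉p (proj₂ (x∈p∩q⁻ (K n (⁅ z ⁆ ∪ U)) _ e∈)) (∉ₑ⇒∈K∁⁅⁆ z∉e)
      other∈U : ∀ {x} → x ∈ₑ e → x ≢ z → x ∈ U
      other∈U x∈e x≢z = [ ⊥-elim ∘ x≢z ∘ x∈⁅y⁆⇒x≡y z , id ]′ (∈-∪⁻ (∈K⁻ {⁅ z ⁆ ∪ U} (starAt⊆K {z} {U} e∈) x∈e))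

  ∪⊆K-VE∪VE : ∀ {E F} → E ∪ F ⊆ K n (VE n E ∪ VE n F)
  ∪⊆K-VE∪VE {E} {F} = ∪-least (K-mono {VE n E} {VE n E ∪ VE n F} ∈-∪⁺ˡ ∘ ⊆K-VE {E})
                              (K-mono {VE n F} {VE n E ∪ VE n F} ∈-∪⁺ʳ ∘ ⊆K-VE {F})

  starAt⊆Δ : ∀ {z B A} → B ⊆ A → starAt z B ⊆ Δ z A
  starAt⊆Δ {z} {B} {A} B⊆A e∈ =
    let z∈e , other∈B = ∈starAt⁻ {z} {B} e∈ ; y∈e , y≢z = opposite-∈ₑ z∈e
    in ∈Δ⁺ {z} {A} z∈e y∈e y≢z (B⊆A (other∈B y∈e y≢z))

  starAt-⊥ : ∀ {z e} → e ∉ starAt z ⊥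
  starAt-⊥ {z} e∈ with z∈e , other∈ ← ∈starAt⁻ {z} {⊥} e∈ with y∈e , y≢z ← opposite-∈ₑ z∈e = ∉⊥ (other∈ y∈e y≢z)

  starAt-insert⊆ : ∀ {z u B e} → u ≢ z → z ∈ₑ e → u ∈ₑ e → starAt z (B ∪ ⁅ u ⁆) ⊆ starAt z B ∪ ⁅ e ⁆
  starAt-insert⊆ {z} {u} {B} {e} u≢z z∈e u∈e {g} g∈
    with z∈g , other∈ ← ∈starAt⁻ {z} {B ∪ ⁅ u ⁆} g∈
    with y∈g , y≢z ← opposite-∈ₑ z∈g
    with ∈-insert⁻ {p = B} (other∈ y∈g y≢z)
  ... | inj₁ y∈B = ∈-∪⁺ˡ (∈starAt⁺ z∈g y∈B y∈g y≢z)
  ... | inj₂ refl = ∈-∪⁺ʳ (subst (_∈ ⁅ e ⁆) (edge-unique (u≢z ∘ sym) z∈e u∈e z∈g y∈g) (x∈⁅x⁆ e))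

-- Necessity of (H1) and (H2); here and below the dimension is m = suc k.

module Necessity (k n : ℕ) (M : Matroid (N n)) (AR : IsAbstractRigidity n M (suc k)) where
  open CompleteGraph n
  open MatroidTheory M
  open Matroid M using (rank; rank-mono)

  C1 : ∀ E F → ∣ VE n E ∩ VE n F ∣ < suc k → σ M (E ∪ F) ⊆ K n (VE n E) ∪ K n (VE n F)
  C1 = proj₁ AR

  C2 : ∀ E F → Rigid n M E → Rigid n M F → suc k ≤ ∣ VE n E ∩ VE n F ∣ → Rigid n M (E ∪ F)
  C2 = proj₂ AR

  VE⊥-empty : ∀ {x} → x ∉ VE n ⊥
  VE⊥-empty x∈ with _ , e∈⊥ , _ ← ∈VE⁻ {⊥} x∈ = ∉⊥ e∈⊥

  σ⊆K-VE : ∀ X → σ M X ⊆ K n (VE n X)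
  σ⊆K-VE X = [ id , (λ e∈K⊥ → ⊥-elim (VE⊥-empty (∈K⁻ {VE n ⊥} e∈K⊥ (end₁∈ₑ _)))) ]′
           ∘ ∈-∪⁻ {p = K n (VE n X)} ∘ C1 X ⊥ (s≤s disjoint) ∘ σ-mono ∈-∪⁺ˡ
    where
      disjoint : ∣ VE n X ∩ VE n ⊥ ∣ ≤ k
      disjoint = ≤-trans (p⊆q⇒∣p∣≤∣q∣ {q = ⊥} (⊥-elim ∘ VE⊥-empty ∘ proj₂ ∘ x∈p∩q⁻ (VE n X) (VE n ⊥)))
                         (≤-trans (≤-reflexive (∣⊥∣≡0 n)) z≤n)

  σ-⊆K : ∀ {X W} → X ⊆ K n W → σ M X ⊆ K n W
  σ-⊆K {X} {W} X⊆KW = K-mono (VE-K⊆ {W} ∘ VE-mono X⊆KW) ∘ σ⊆K-VE X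

  K-rigid : ∀ W → Rigid n M (K n W)
  K-rigid W = ⊆-antisym (σ-⊆K {K n W} {VE n (K n W)} (⊆K-VE {K n W})) (⊆σ ∘ K-mono {VE n (K n W)} (VE-K⊆ {W}))

  ∈σ-K∪K : ∀ {X Y U h} → U ⊆ VE n (K n X) ∩ VE n (K n Y) → suc k ≤ ∣ U ∣ →
           (∀ {x} → x ∈ₑ h → x ∈ VE n (K n X) ∪ VE n (K n Y)) → h ∈ σ M (K n X ∪ K n Y)
  ∈σ-K∪K {X} {Y} U⊆ big ends∈ = subst (_ ∈_) (sym rigid) (∈K⁺ {VE n (K n X ∪ K n Y)} (VE-∪⊇ {K n X} {K n Y} ∘ ends∈))
    where
      rigid : Rigid n M (K n X ∪ K n Y)
      rigid = C2 _ _ (K-rigid X) (K-rigid Y) (≤-trans big (p⊆q⇒∣p∣≤∣q∣ U⊆))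

  module _ {H U} (U⊆full : U ⊆ fullVertices n M H) (∣U∣≡ : ∣ U ∣ ≡ suc k) where
    private
      full : ∀ {u e} → u ∈ U → u ∈ₑ e → e ∈ H
      full u∈U = ∈fullVertices⁻ M (U⊆full u∈U)

      K-insert⊆H : ∀ {x} → x ∉ U → K n (U ∪ ⁅ x ⁆) ⊆ H
      K-insert⊆H {x} x∉U {f} f∈K with ∈-insert⁻ {p = U} (∈K⁻ {U ∪ ⁅ x ⁆} f∈K (end₁∈ₑ f))
                                   | ∈-insert⁻ {p = U} (∈K⁻ {U ∪ ⁅ x ⁆} f∈K (end₂∈ₑ f))
      ... | inj₁ a∈U | _ = full a∈U (end₁∈ₑ f)
      ... | inj₂ _ | inj₁ b∈U = full b∈U (end₂∈ₑ f)
      ... | inj₂ a≡x | inj₂ b≡x = ⊥-elim (end₁≢end₂ f (trans a≡x (sym b≡x)))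

      U⊆VE : ∀ {x} → x ∉ U → U ⊆ VE n (K n (U ∪ ⁅ x ⁆))
      U⊆VE x∉U u∈U = ∈VE-K⁺ (∈-∪⁺ˡ u∈U) ∈-insert⁺ λ { refl → x∉U u∈U }

      new∈VE : ∀ {x} → x ∉ U → x ∈ VE n (K n (U ∪ ⁅ x ⁆))
      new∈VE x∉U with u , u∈U ← 0<∣p∣⇒∃∈ U (subst (0 <_) (sym ∣U∣≡) (s≤s z≤n)) =
        ∈VE-K⁺ ∈-insert⁺ (∈-∪⁺ˡ u∈U) λ { refl → x∉U u∈U }

    -- An edge ab away from U lies in the closure of K(U ∪ {a}) ∪ K(U ∪ {b}) ⊆ H,
    -- a rigid union by (C2) since the two parts share the m vertices of U.
    full-vertices-span : Flat H → ∀ h → h ∈ H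
    full-vertices-span flat h with end₁ h ∈? U | end₂ h ∈? U
    ... | yes a∈U | _ = full a∈U (end₁∈ₑ h)
    ... | no _ | yes b∈U = full b∈U (end₂∈ₑ h)
    ... | no a∉U | no b∉U =
      flat (σ-mono (∪-least (K-insert⊆H a∉U) (K-insert⊆H b∉U))
             (∈σ-K∪K {U ∪ ⁅ end₁ h ⁆} {U ∪ ⁅ end₂ h ⁆} (λ u∈U → x∈p∩q⁺ (U⊆VE a∉U u∈U , U⊆VE b∉U u∈U))
                     (≤-reflexive (sym ∣U∣≡)) λ { (inj₁ refl) → ∈-∪⁺ˡ (new∈VE a∉U) ; (inj₂ refl) → ∈-∪⁺ʳ (new∈VE b∉U) }))

  fullVertices-bound : ∀ H → Hyperplane M H → ∣ fullVertices n M H ∣ ≤ k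
  fullVertices-bound H hyp = decidable-stable (∣ fullVertices n M H ∣ ≤? k) λ ≰k →
    let U , U⊆full , ∣U∣≡ = ∃-⊆-of-size _ (suc k) (≰⇒> ≰k)
    in <⇒≱ (hyperplane⇒rank< hyp) (rank-mono ⊤ H λ {h} _ → full-vertices-span U⊆full ∣U∣≡ (hyperplane⇒flat hyp) h)

  Δ-flat : ∀ {v A} → ∣ A ∣ ≡ k → Flat (Δ v A)
  Δ-flat {v} {A} ∣A∣≡k =
    ∪-mono (K-mono {VE n (K n (⁅ v ⁆ ∪ A))} (VE-K⊆ {⁅ v ⁆ ∪ A})) (K-mono {VE n (K n (∁ ⁅ v ⁆))} (VE-K⊆ {∁ ⁅ v ⁆}))
    ∘ C1 (K n (⁅ v ⁆ ∪ A)) (K n (∁ ⁅ v ⁆)) (s≤s (≤-trans (p⊆q⇒∣p∣≤∣q∣ common⊆A) (≤-reflexive ∣A∣≡k)))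
    where
      common⊆A : VE n (K n (⁅ v ⁆ ∪ A)) ∩ VE n (K n (∁ ⁅ v ⁆)) ⊆ A
      common⊆A x∈ with x∈₁ , x∈₂ ← x∈p∩q⁻ (VE n (K n (⁅ v ⁆ ∪ A))) _ x∈
                  with ∈-∪⁻ {p = ⁅ v ⁆} (VE-K⊆ {⁅ v ⁆ ∪ A} x∈₁)
      ... | inj₁ x∈⁅v⁆ = ⊥-elim (x∈∁p⇒x∉p (VE-K⊆ {∁ ⁅ v ⁆} x∈₂) x∈⁅v⁆)
      ... | inj₂ x∈A = x∈A

  Δ-rank< : ∀ {v A} → suc k < n → ∣ A ∣ ≡ k → rank (Δ v A) < fullRank
  Δ-rank< {v} {A} k<n ∣A∣≡k
    with w , w∉ ← ∣p∣<n⇒∃∉ (⁅ v ⁆ ∪ A) (≤-<-trans (≤-trans (∣⁅x⁆∪p∣≤ v A) (≤-reflexive (cong suc ∣A∣≡k))) k<n)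
    with e , v∈e , w∈e ← ∃edge {v} {w} (λ { refl → w∉ (∈-∪⁺ˡ (x∈⁅x⁆ v)) })
    = begin-strict
      rank (Δ v A)                <⟨ ≤-reflexive (sym (∉σ⇒rank-suc (∉Δ {v} {A} v∈e w∈e w∉ ∘ Δ-flat {v} {A} ∣A∣≡k))) ⟩
      rank (Δ v A ∪ ⁅ e ⁆)        ≤⟨ rank≤fullRank _ ⟩
      fullRank                    ∎
    where open ≤-Reasoning

  module _ {v A e} (v∉A : v ∉ A) (∣A∣≡k : ∣ A ∣ ≡ k) (e∉Δ : e ∉ Δ v A) where
    private
      v∈e : v ∈ₑ e
      v∈e = ∉Δ⇒∈ₑ {v} {A} e∉Δ

      w : Fin n
      w = opposite v e

      w∈e : w ∈ₑ e
      w∈e = proj₁ (opposite-∈ₑ v∈e)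

      w≢v : w ≢ v
      w≢v = proj₂ (opposite-∈ₑ v∈e)

      w∉A : w ∉ A
      w∉A w∈A = e∉Δ (∈Δ⁺ v∈e w∈e w≢v w∈A)

      edge-at-v : ∀ {f y} → v ∈ₑ f → y ∈ₑ f → y ≢ v → y ∈ A ⊎ y ≡ w → f ∈ Δ v A ∪ ⁅ e ⁆
      edge-at-v v∈f y∈f y≢v (inj₁ y∈A) = ∈-∪⁺ˡ (∈Δ⁺ v∈f y∈f y≢v y∈A)
      edge-at-v v∈f y∈f y≢v (inj₂ refl) =
        subst (_∈ Δ v A ∪ ⁅ e ⁆) (edge-unique (w≢v ∘ sym) v∈e w∈e v∈f y∈f) ∈-insert⁺

      K-star⊆ : K n (⁅ v ⁆ ∪ (A ∪ ⁅ w ⁆)) ⊆ Δ v A ∪ ⁅ e ⁆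
      K-star⊆ {f} f∈K with v ∈ₑ? f
      ... | no v∉f = ∈-∪⁺ˡ (∉ₑ⇒∈Δ v∉f)
      ... | yes v∈f with y∈f , y≢v ← opposite-∈ₑ v∈f
                    with ∈-∪⁻ {p = ⁅ v ⁆} (∈K⁻ {⁅ v ⁆ ∪ (A ∪ ⁅ w ⁆)} f∈K y∈f)
      ...   | inj₁ y∈⁅v⁆ = ⊥-elim (y≢v (x∈⁅y⁆⇒x≡y v y∈⁅v⁆))
      ...   | inj₂ y∈A∪w = edge-at-v v∈f y∈f y≢v (∈-insert⁻ y∈A∪w)

      ∈A∪w⇒≢v : ∀ {a} → a ∈ A ∪ ⁅ w ⁆ → a ≢ v
      ∈A∪w⇒≢v a∈ refl = [ v∉A , w≢v ∘ sym ]′ (∈-insert⁻ a∈)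

      ∈VE-K∁⁅v⁆ : ∀ {a b} → a ≢ v → b ≢ v → a ≢ b → a ∈ VE n (K n (∁ ⁅ v ⁆))
      ∈VE-K∁⁅v⁆ a≢v b≢v = ∈VE-K⁺ (∈∁⁅⁆⁺ a≢v) (∈∁⁅⁆⁺ b≢v)

      ∈VE-K-star : ∀ {a} → a ∈ A ∪ ⁅ w ⁆ → a ∈ VE n (K n (⁅ v ⁆ ∪ (A ∪ ⁅ w ⁆)))
      ∈VE-K-star a∈ = ∈VE-K⁺ (∈-∪⁺ʳ a∈) (∈-∪⁺ˡ (x∈⁅x⁆ v)) (∈A∪w⇒≢v a∈)

      -- An edge vy with y ∉ A ∪ {w} is spanned by the rigid union of K(V ∖ {v}) and
      -- K({v} ∪ A ∪ {w}), which share the m vertices A ∪ {w}.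
      edge-at-v-spans : ∀ {h y} → v ∈ₑ h → y ∈ₑ h → y ≢ v → h ∈ σ M (Δ v A ∪ ⁅ e ⁆)
      edge-at-v-spans {h} {y} v∈h y∈h y≢v with y ∈? A | y ≟ w
      ... | yes y∈A | _ = ⊆σ (edge-at-v v∈h y∈h y≢v (inj₁ y∈A))
      ... | no _ | yes y≡w = ⊆σ (edge-at-v v∈h y∈h y≢v (inj₂ y≡w))
      ... | no y∉A | no y≢w = σ-mono (∪-least (∈-∪⁺ˡ ∘ ∈-∪⁺ʳ) K-star⊆)
              (∈σ-K∪K {∁ ⁅ v ⁆} {⁅ v ⁆ ∪ (A ∪ ⁅ w ⁆)} {A ∪ ⁅ w ⁆} common
                (≤-reflexive (sym (trans (∣insert∣ A w∉A) (cong suc ∣A∣≡k)))) ends∈)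
        where
          common : A ∪ ⁅ w ⁆ ⊆ VE n (K n (∁ ⁅ v ⁆)) ∩ VE n (K n (⁅ v ⁆ ∪ (A ∪ ⁅ w ⁆)))
          common {a} a∈ with a ≟ w
          ... | yes refl = x∈p∩q⁺ (∈VE-K∁⁅v⁆ w≢v y≢v (y≢w ∘ sym) , ∈VE-K-star a∈)
          ... | no a≢w = x∈p∩q⁺ (∈VE-K∁⁅v⁆ (∈A∪w⇒≢v a∈) w≢v a≢w , ∈VE-K-star a∈)
          ends∈ : ∀ {x} → x ∈ₑ h → x ∈ VE n (K n (∁ ⁅ v ⁆)) ∪ VE n (K n (⁅ v ⁆ ∪ (A ∪ ⁅ w ⁆)))
          ends∈ x∈h with ∈ₑ-two v∈h y∈h (y≢v ∘ sym) x∈h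
          ... | inj₁ refl = ∈-∪⁺ʳ (∈VE-K⁺ (∈-∪⁺ˡ (x∈⁅x⁆ v)) (∈-∪⁺ʳ ∈-insert⁺) (w≢v ∘ sym))
          ... | inj₂ refl = ∈-∪⁺ˡ (∈VE-K∁⁅v⁆ y≢v w≢v y≢w)

    Δ-insert-spans : ∀ h → h ∈ σ M (Δ v A ∪ ⁅ e ⁆)
    Δ-insert-spans h with v ∈ₑ? h
    ... | no v∉h = ⊆σ (∈-∪⁺ˡ (∉ₑ⇒∈Δ v∉h))
    ... | yes v∈h = edge-at-v-spans v∈h (proj₁ (opposite-∈ₑ v∈h)) (proj₂ (opposite-∈ₑ v∈h))

  Δ-hyperplane : ∀ v A → suc k < n → v ∉ A → ∣ A ∣ ≡ k → Hyperplane M (Δ v A)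
  Δ-hyperplane v A k<n v∉A ∣A∣≡k = hyperplane-by-rank (Δ-rank< {v} {A} k<n ∣A∣≡k)
    λ e e∉Δ → spanning⇒fullRank≤ (Δ-insert-spans v∉A ∣A∣≡k e∉Δ)

-- Sufficiency of (H1) and (H2)

module Sufficiency (k n : ℕ) (k<n : suc k < n) (M : Matroid (N n))
  (H1 : ∀ H → Hyperplane M H → ∣ fullVertices n M H ∣ ≤ k)
  (H2 : ∀ v A → v ∉ A → ∣ A ∣ ≡ k → Hyperplane M (CompleteGraph.Δ n v A)) where
  open CompleteGraph n
  open MatroidTheory M

  Avoids : EdgeSet n → Fin n → Set
  Avoids X z = ∀ {e} → e ∈ X → ¬ z ∈ₑ e

  -- The witness is Δ z A for some A ⊇ B of size m − 1 avoiding z and t.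
  separating-flat : ∀ {z t B} → z ≢ t → z ∉ B → t ∉ B → ∣ B ∣ ≤ k →
                    ∃ λ F → Flat F × (∀ {e} → ¬ z ∈ₑ e → e ∈ F) × starAt z B ⊆ F × (∀ {e} → z ∈ₑ e → t ∈ₑ e → e ∉ F)
  separating-flat {z} {t} {B} z≢t z∉B t∉B ∣B∣≤k =
    let A , B⊆A , z∉A , t∉A , ∣A∣≡k = ∃-⊇-avoiding-pair k z≢t z∉B t∉B ∣B∣≤k (∸-monoˡ-≤ 2 k<n)
    in Δ z A , hyperplane⇒flat (H2 z A z∉A ∣A∣≡k) , ∉ₑ⇒∈Δ {z} {A} , starAt⊆Δ {z} B⊆A
     , λ z∈e t∈e → ∉Δ {z} {A} z∈e t∈e ([ z≢t ∘ sym ∘ x∈⁅y⁆⇒x≡y z , t∉A ]′ ∘ ∈-∪⁻)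

  K-flat : ∀ W → Flat (K n W)
  K-flat W {e} e∈σK = decidable-stable (e ∈? K n W) λ e∉K →
    let a , a∈e , a∉W = ∉K⇒∃end∉ {W} e∉K
        b∈e , b≢a = opposite-∈ₑ a∈e
        F , flat , avoiding⊆F , _ , ab∉F = separating-flat (b≢a ∘ sym) ∉⊥ ∉⊥ (≤-trans (≤-reflexive (∣⊥∣≡0 n)) z≤n)
    in flat-∉σ flat (λ f∈K → avoiding⊆F (a∉W ∘ ∈K⁻ {W} f∈K)) (ab∉F a∈e b∈e) e∈σK

  -- The flat given by separating-flat contains X, the edges from z to B and f, but not zu.
  ∉σ-∪-starAt-insert : ∀ {X f z u B} → z ≢ u → z ∉ B → u ∉ B → ∣ B ∣ ≤ k → Avoids X z → ¬ z ∈ₑ f →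
                       f ∉ σ M (X ∪ starAt z B) → f ∉ σ M (X ∪ starAt z (B ∪ ⁅ u ⁆))
  ∉σ-∪-starAt-insert {X} {f} {z} {u} {B} z≢u z∉B u∉B ∣B∣≤k X-avoids f-avoids f∉σ =
    let e , z∈e , u∈e = ∃edge z≢u
        F , flat , avoiding⊆F , starAt⊆F , zu∉F = separating-flat z≢u z∉B u∉B ∣B∣≤k
    in flat-∉σ-insert flat (∪-least (avoiding⊆F ∘ X-avoids) starAt⊆F) (avoiding⊆F f-avoids) (zu∉F z∈e u∈e) f∉σ
       ∘ σ-mono (⊆-reflexive (sym (∪-assoc X (starAt z B) ⁅ e ⁆)) ∘ ∪-mono ⊆-refl (starAt-insert⊆ {B = B} (z≢u ∘ sym) z∈e u∈e))

  ∉σ-∪-starAt : ∀ {X f z} U → z ∉ U → ∣ U ∣ ≤ suc k → Avoids X z → ¬ z ∈ₑ f → f ∉ σ M X → f ∉ σ M (X ∪ starAt z U)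
  ∉σ-∪-starAt {X} {f} {z} U z∉U ∣U∣≤ X-avoids f-avoids f∉σX =
    ⊆-induction (λ B → f ∉ σ M (X ∪ starAt z B)) (f∉σX ∘ σ-mono (∪-least ⊆-refl (⊥-elim ∘ starAt-⊥ {z})))
      λ {B} {u} Bu⊆U u∉B → ∉σ-∪-starAt-insert (λ { refl → z∉U (Bu⊆U ∈-insert⁺) }) (z∉U ∘ Bu⊆U ∘ ∈-∪⁺ˡ) u∉B
        (≤-pred (≤-trans (≤-reflexive (sym (∣insert∣ B u∉B))) (≤-trans (p⊆q⇒∣p∣≤∣q∣ Bu⊆U) ∣U∣≤))) X-avoids f-avoids

  -- A hyperplane containing star U would have all of U as full vertices, against (H1).
  star-spans : ∀ {U} → ∣ U ∣ ≡ suc k → ∀ f → f ∈ σ M (star U)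
  star-spans {U} ∣U∣≡ f = decidable-stable (f ∈? σ M (star U)) λ f∉σ →
    let H , hyp , star⊆H = ∉σ⇒∃hyperplane⊇ f f∉σ
        U⊆full : U ⊆ fullVertices n M H
        U⊆full u∈U = ∈fullVertices⁺ M (≤-<-trans (s≤s z≤n) k<n) (λ u∈e → star⊆H (∈star⁺ u∈U u∈e))
    in 1+n≰n (begin
      suc k                       ≡⟨ ∣U∣≡ ⟨
      ∣ U ∣                       ≤⟨ p⊆q⇒∣p∣≤∣q∣ U⊆full ⟩
      ∣ fullVertices n M H ∣      ≤⟨ H1 H hyp ⟩
      k                           ∎)
    where open ≤-Reasoning

  ⋃starAt : Subset n → List (Fin n) → EdgeSet n
  ⋃starAt U [] = ⊥
  ⋃starAt U (z ∷ zs) = starAt z U ∪ ⋃starAt U zs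

  starAt⊆⋃starAt : ∀ {U z zs} → z ∈ₗ zs → starAt z U ⊆ ⋃starAt U zs
  starAt⊆⋃starAt (here refl) = ∈-∪⁺ˡ
  starAt⊆⋃starAt (there z∈zs) = ∈-∪⁺ʳ ∘ starAt⊆⋃starAt z∈zs

  ∉σ-∪-⋃starAt : ∀ {U Y f} zs → Unique zs → ∣ U ∣ ≤ suc k → (∀ {z} → z ∈ₗ zs → z ∉ U × Avoids Y z × ¬ z ∈ₑ f) →
                 f ∉ σ M Y → f ∉ σ M (Y ∪ ⋃starAt U zs)
  ∉σ-∪-⋃starAt [] _ _ _ f∉σY = f∉σY ∘ σ-mono (∪-least ⊆-refl (⊥-elim ∘ ∉⊥))
  ∉σ-∪-⋃starAt {U} {Y} {f} (z ∷ zs) (z∉zs ∷ zs!) ∣U∣≤ away f∉σY =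
    subst (λ Z → f ∉ σ M Z) (∪-assoc Y (starAt z U) (⋃starAt U zs))
      (∉σ-∪-⋃starAt zs zs! ∣U∣≤ away′ (∉σ-∪-starAt U z∉U ∣U∣≤ Y-avoids f-avoids f∉σY))
    where
      z∉U = proj₁ (away (here refl))
      Y-avoids = proj₁ (proj₂ (away (here refl)))
      f-avoids = proj₂ (proj₂ (away (here refl)))
      away′ : ∀ {z′} → z′ ∈ₗ zs → z′ ∉ U × Avoids (Y ∪ starAt z U) z′ × ¬ z′ ∈ₑ f
      away′ {z′} z′∈zs = z′∉U , Y∪starAt-avoids , proj₂ (proj₂ (away (there z′∈zs)))
        where
          z′∉U = proj₁ (away (there z′∈zs))
          Y∪starAt-avoids : Avoids (Y ∪ starAt z U) z′
          Y∪starAt-avoids e∈ z′∈e = [ (λ e∈Y → proj₁ (proj₂ (away (there z′∈zs))) e∈Y z′∈e)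
                                    , (λ e∈starAt → z′∉U (proj₂ (∈starAt⁻ {z} {U} e∈starAt) z′∈e λ { refl → All.lookup z∉zs z′∈zs refl }))
                                    ]′ (∈-∪⁻ {p = Y} e∈)

  -- By star-spans e is spanned by star U. Of its edges, those from U to the vertices z
  -- outside T ∪ {p} can be dropped one star at a time, since the rest avoids z.
  ∈σ-K∪starAt : ∀ {U T p t e} → U ⊆ T → ∣ U ∣ ≡ suc k → p ∉ T → t ∈ T → p ∈ₑ e → t ∈ₑ e →
                e ∈ σ M (K n T ∪ starAt p U)
  ∈σ-K∪starAt {U} {T} {p} {t} {e} U⊆T ∣U∣≡ p∉T t∈T p∈e t∈e = decidable-stable (e ∈? σ M (K n T ∪ starAt p U)) λ e∉σ →
    ∉σ-∪-⋃starAt zs (Uniqueₚ.filter⁺ _ (Uniqueₚ.allFin⁺ n)) (≤-reflexive ∣U∣≡) away e∉σ (σ-mono star⊆ (star-spans {U} ∣U∣≡ e))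
    where
      zs = toList (∁ (T ∪ ⁅ p ⁆))
      ∉T∪⁅p⁆ : ∀ {z} → z ∉ T → z ≢ p → z ∈ ∁ (T ∪ ⁅ p ⁆)
      ∉T∪⁅p⁆ z∉T z≢p = x∉p⇒x∈∁p ([ z∉T , z≢p ∘ x∈⁅y⁆⇒x≡y _ ]′ ∘ ∈-∪⁻)
      away : ∀ {z} → z ∈ₗ zs → z ∉ U × Avoids (K n T ∪ starAt p U) z × ¬ z ∈ₑ e
      away {z} z∈zs = z∉T ∘ U⊆T , K∪starAt-avoids , e-avoids
        where
          z∉T∪p = x∈∁p⇒x∉p (∈-toList⁻ z∈zs)
          z∉T : z ∉ T
          z∉T = z∉T∪p ∘ ∈-∪⁺ˡ
          z≢p : z ≢ p
          z≢p refl = z∉T∪p ∈-insert⁺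
          K∪starAt-avoids : Avoids (K n T ∪ starAt p U) z
          K∪starAt-avoids e′∈ z∈e′ = z∉T ([ (λ e′∈K → ∈K⁻ {T} e′∈K z∈e′)
                                         , (λ e′∈starAt → U⊆T (proj₂ (∈starAt⁻ {p} {U} e′∈starAt) z∈e′ z≢p))
                                         ]′ (∈-∪⁻ {p = K n T} e′∈))
          e-avoids : ¬ z ∈ₑ e
          e-avoids z∈e = [ z≢p , (λ { refl → z∉T t∈T }) ]′ (∈ₑ-two p∈e t∈e (λ { refl → p∉T t∈T }) z∈e)
      edge-from-U : ∀ {u w e′} → u ∈ U → u ∈ₑ e′ → w ∈ₑ e′ × w ≢ u → e′ ∈ (K n T ∪ starAt p U) ∪ ⋃starAt U zs
      edge-from-U {u} {w} u∈U u∈e′ (w∈e′ , w≢u) = case ((w ∈? T) ,′ (w ≟ p)) of λ where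
        (yes w∈T , _) → ∈-∪⁺ˡ (∈-∪⁺ˡ (∈K-ends {T} u∈e′ w∈e′ (w≢u ∘ sym) (U⊆T u∈U) w∈T))
        (no _ , yes refl) → ∈-∪⁺ˡ (∈-∪⁺ʳ (∈starAt⁺ w∈e′ u∈U u∈e′ (w≢u ∘ sym)))
        (no w∉T , no w≢p) → ∈-∪⁺ʳ (starAt⊆⋃starAt (∈-toList⁺ (∉T∪⁅p⁆ w∉T w≢p)) (∈starAt⁺ w∈e′ u∈U u∈e′ (w≢u ∘ sym)))
      star⊆ : star U ⊆ (K n T ∪ starAt p U) ∪ ⋃starAt U zs
      star⊆ e′∈ = let u , u∈U , u∈e′ = ∈star⁻ {U} e′∈ in edge-from-U u∈U u∈e′ (opposite-∈ₑ u∈e′)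

  module _ {S Q a b e} (∣S∣≡k : ∣ S ∣ ≡ k) (a∉Q : a ∉ Q) (a∉S : a ∉ S) (b∈Q : b ∈ Q) (b∉S : b ∉ S)
           (a∈e : a ∈ₑ e) (b∈e : b ∈ₑ e) where
    private
      G : Subset n → EdgeSet n
      G R = K n (S ∪ (⁅ a ⁆ ∪ R)) ∪ K n (∁ (⁅ a ⁆ ∪ R))

      G⊥-separates : e ∉ σ M (G ⊥)
      G⊥-separates = flat-∉σ (hyperplane⇒flat (H2 a S a∉S ∣S∣≡k)) G⊥⊆Δ (∉Δ {a} {S} a∈e b∈e b∉⁅a⁆∪S)
        where
          G⊥⊆Δ : G ⊥ ⊆ Δ a S
          G⊥⊆Δ = ∪-mono (K-mono {S ∪ (⁅ a ⁆ ∪ ⊥)} (∪-least ∈-∪⁺ʳ (∪-least ∈-∪⁺ˡ (⊥-elim ∘ ∉⊥))))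
                        (K-mono {∁ (⁅ a ⁆ ∪ ⊥)} (p⊆q⇒∁p⊇∁q ∈-∪⁺ˡ))
          b∉⁅a⁆∪S : b ∉ ⁅ a ⁆ ∪ S
          b∉⁅a⁆∪S = [ (λ b∈⁅a⁆ → a∉Q (subst (_∈ Q) (x∈⁅y⁆⇒x≡y a b∈⁅a⁆) b∈Q)) , b∉S ]′ ∘ ∈-∪⁻

      -- Moving one more vertex p from the second part of G R to the first only adds
      -- edges at p, which local spanning recovers from a star at p of m vertices.
      G-insert-separates : ∀ {R p} → p ∉ Q × p ∉ S × p ≢ a → p ∉ R → e ∉ σ M (G R) → e ∉ σ M (G (R ∪ ⁅ p ⁆))
      G-insert-separates {R} {p} (p∉Q , p∉S , p≢a) p∉R e∉σGR = e∉σ ∘ ⊆σ⇒σ⊆σ GRp⊆σ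
        where
          T = S ∪ (⁅ a ⁆ ∪ R)
          U = S ∪ ⁅ a ⁆
          G′ = K n T ∪ K n (∁ (⁅ a ⁆ ∪ (R ∪ ⁅ p ⁆)))
          p∉T : p ∉ T
          p∉T = [ p∉S , [ p≢a ∘ x∈⁅y⁆⇒x≡y a , p∉R ]′ ∘ ∈-∪⁻ ]′ ∘ ∈-∪⁻
          U⊆T : U ⊆ T
          U⊆T = ∪-least ∈-∪⁺ˡ (∈-∪⁺ʳ ∘ ∈-∪⁺ˡ)
          ∈T : ∀ {x} → x ∈ S ∪ (⁅ a ⁆ ∪ (R ∪ ⁅ p ⁆)) → x ≢ p → x ∈ T
          ∈T x∈ x≢p = [ ∈-∪⁺ˡ , [ ∈-∪⁺ʳ ∘ ∈-∪⁺ˡ , [ ∈-∪⁺ʳ ∘ ∈-∪⁺ʳ , ⊥-elim ∘ x≢p ]′ ∘ ∈-insert⁻ ]′ ∘ ∈-∪⁻ ]′ (∈-∪⁻ x∈)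
          G′-avoids : Avoids G′ p
          G′-avoids f∈ p∈f = [ (λ f∈KT → p∉T (∈K⁻ {T} f∈KT p∈f))
                             , (λ f∈K∁ → x∈∁p⇒x∉p (∈K⁻ {∁ (⁅ a ⁆ ∪ (R ∪ ⁅ p ⁆))} f∈K∁ p∈f) (∈-∪⁺ʳ ∈-insert⁺))
                             ]′ (∈-∪⁻ {p = K n T} f∈)
          e-avoids : ¬ p ∈ₑ e
          e-avoids p∈e = [ p≢a , (λ { refl → p∉Q b∈Q }) ]′ (∈ₑ-two a∈e b∈e (λ { refl → a∉Q b∈Q }) p∈e)
          e∉σ : e ∉ σ M (G′ ∪ starAt p U)
          e∉σ = ∉σ-∪-starAt U (p∉T ∘ U⊆T) (≤-reflexive (trans (∣insert∣ S a∉S) (cong suc ∣S∣≡k))) G′-avoids e-avoids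
                  (e∉σGR ∘ σ-mono (∪-mono ⊆-refl (K-mono {∁ (⁅ a ⁆ ∪ (R ∪ ⁅ p ⁆))} (p⊆q⇒∁p⊇∁q (∪-mono ⊆-refl ∈-∪⁺ˡ)))))
          GRp⊆σ : G (R ∪ ⁅ p ⁆) ⊆ σ M (G′ ∪ starAt p U)
          GRp⊆σ = ∪-least first (⊆σ ∘ ∈-∪⁺ˡ ∘ ∈-∪⁺ʳ)
            where
              first : K n (S ∪ (⁅ a ⁆ ∪ (R ∪ ⁅ p ⁆))) ⊆ σ M (G′ ∪ starAt p U)
              first {f} f∈ = case p ∈ₑ? f of λ where
                (no p∉f) → ⊆σ (∈-∪⁺ˡ (∈-∪⁺ˡ (∈K⁺ {T} λ {x} x∈f → ∈T (∈K⁻ {S ∪ (⁅ a ⁆ ∪ (R ∪ ⁅ p ⁆))} f∈ x∈f) λ { refl → p∉f x∈f })))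
                (yes p∈f) → let t∈f , t≢p = opposite-∈ₑ p∈f in σ-mono (∪-mono ∈-∪⁺ˡ ⊆-refl)
                  (∈σ-K∪starAt U⊆T (trans (∣insert∣ S a∉S) (cong suc ∣S∣≡k)) p∉T (∈T (∈K⁻ {S ∪ (⁅ a ⁆ ∪ (R ∪ ⁅ p ⁆))} f∈ t∈f) t≢p) p∈f t∈f)

    -- Starting from Δ a S and moving the vertices outside Q ∪ S ∪ {a} across one at a time.
    separation : e ∉ σ M (K n (∁ Q ∪ S) ∪ K n (Q ∪ S))
    separation = ⊆-induction {q = P} (λ R → e ∉ σ M (G R)) G⊥-separates
                   (λ Rp⊆P p∉R → G-insert-separates (fresh (Rp⊆P ∈-insert⁺)) p∉R)
                 ∘ σ-mono (∪-mono (K-mono {∁ Q ∪ S} first⊆) (K-mono {Q ∪ S} second⊆))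
      where
        P = ∁ (Q ∪ (S ∪ ⁅ a ⁆))
        fresh : ∀ {p} → p ∈ P → p ∉ Q × p ∉ S × p ≢ a
        fresh p∈P = let p∉ = x∈∁p⇒x∉p p∈P in p∉ ∘ ∈-∪⁺ˡ , p∉ ∘ ∈-∪⁺ʳ ∘ ∈-∪⁺ˡ , λ { refl → p∉ (∈-∪⁺ʳ ∈-insert⁺) }
        first⊆ : ∁ Q ∪ S ⊆ S ∪ (⁅ a ⁆ ∪ P)
        first⊆ {x} x∈ with x ∈? S | x ≟ a
        ... | yes x∈S | _ = ∈-∪⁺ˡ x∈S
        ... | no _ | yes refl = ∈-∪⁺ʳ (∈-∪⁺ˡ (x∈⁅x⁆ a))
        ... | no x∉S | no x≢a = ∈-∪⁺ʳ (∈-∪⁺ʳ (x∉p⇒x∈∁p ([ x∈∁p⇒x∉p x∉Q , [ x∉S , x≢a ∘ x∈⁅y⁆⇒x≡y a ]′ ∘ ∈-∪⁻ ]′ ∘ ∈-∪⁻)))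
          where x∉Q = [ (λ x∈∁Q → x∈∁Q) , ⊥-elim ∘ x∉S ]′ (∈-∪⁻ x∈)
        second⊆ : Q ∪ S ⊆ ∁ (⁅ a ⁆ ∪ P)
        second⊆ {x} x∈ = x∉p⇒x∈∁p ([ (λ x∈⁅a⁆ → [ a∉Q , a∉S ]′ (subst (λ y → y ∈ Q ⊎ y ∈ S) (x∈⁅y⁆⇒x≡y a x∈⁅a⁆) (∈-∪⁻ x∈)))
                                   , (λ x∈P → x∈∁p⇒x∉p x∈P ([ ∈-∪⁺ˡ , ∈-∪⁺ʳ ∘ ∈-∪⁺ˡ ]′ (∈-∪⁻ x∈))) ]′ ∘ ∈-∪⁻)

  crossing-∉σ : ∀ {X Y x y e Z} → ∣ X ∩ Y ∣ ≤ k → x ∈ X → x ∉ Y → y ∈ Y → y ∉ X → x ∈ₑ e → y ∈ₑ e →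
                Z ⊆ K n X ∪ K n Y → e ∉ σ M Z
  crossing-∉σ {X} {Y} {x} {y} ∣X∩Y∣≤k x∈X x∉Y y∈Y y∉X x∈e y∈e Z⊆ =
    let S , X∩Y⊆S , x∉S , y∉S , ∣S∣≡k = ∃-⊇-avoiding-pair k (λ { refl → x∉Y y∈Y })
          (x∉Y ∘ proj₂ ∘ x∈p∩q⁻ X Y) (y∉X ∘ proj₁ ∘ x∈p∩q⁻ X Y) ∣X∩Y∣≤k (∸-monoˡ-≤ 2 k<n)
        X⊆ : X ⊆ ∁ Y ∪ S
        X⊆ = λ {x′} x′∈X → case x′ ∈? Y of λ where
          (yes x′∈Y) → ∈-∪⁺ʳ (X∩Y⊆S (x∈p∩q⁺ (x′∈X , x′∈Y)))
          (no x′∉Y) → ∈-∪⁺ˡ (x∉p⇒x∈∁p x′∉Y)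
    in separation ∣S∣≡k x∉Y x∉S y∈Y y∉S x∈e y∈e ∘ σ-mono (∪-mono (K-mono {X} X⊆) (K-mono {Y} ∈-∪⁺ˡ) ∘ Z⊆)

  Crossing : Subset n → Subset n → Fin (N n) → Set
  Crossing X Y e = ∃ λ x → ∃ λ y → x ∈ₑ e × y ∈ₑ e × x ∈ X × x ∉ Y × y ∈ Y × y ∉ X

  ∈K-∪-∉ˡ : ∀ {X Y e x} → e ∈ K n (X ∪ Y) → x ∈ₑ e → x ∉ X → x ∈ Y
  ∈K-∪-∉ˡ {X} {Y} e∈K x∈e x∉X = [ ⊥-elim ∘ x∉X , (λ x∈Y → x∈Y) ]′ (∈-∪⁻ (∈K⁻ {X ∪ Y} e∈K x∈e))

  K-∪-one-end-outside : ∀ {X Y e x y} → e ∈ K n (X ∪ Y) → x ∈ₑ e → y ∈ₑ e → x ∈ X → y ∉ X →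
                        e ∈ K n Y ⊎ Crossing X Y e
  K-∪-one-end-outside {X} {Y} {e} {x} {y} e∈K x∈e y∈e x∈X y∉X =
    let y∈Y = ∈K-∪-∉ˡ {X} e∈K y∈e y∉X in case x ∈? Y of λ where
      (yes x∈Y) → inj₁ (∈K-ends {Y} x∈e y∈e (λ { refl → y∉X x∈X }) x∈Y y∈Y)

      (no x∉Y) → inj₂ (x , y , x∈e , y∈e , x∈X , x∉Y , y∈Y , y∉X)

  K-∪-cases : ∀ {X Y e} → e ∈ K n (X ∪ Y) → e ∈ K n X ⊎ e ∈ K n Y ⊎ Crossing X Y e
  K-∪-cases {X} {Y} {e} e∈K = case ((end₁ e ∈? X) ,′ (end₂ e ∈? X)) of λ where
    (yes a∈X , yes b∈X) → inj₁ (∈K⁺ {X} λ { (inj₁ refl) → a∈X ; (inj₂ refl) → b∈X })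
    (yes a∈X , no b∉X) → inj₂ (K-∪-one-end-outside e∈K (end₁∈ₑ e) (end₂∈ₑ e) a∈X b∉X)
    (no a∉X , yes b∈X) → inj₂ (K-∪-one-end-outside e∈K (end₂∈ₑ e) (end₁∈ₑ e) b∈X a∉X)
    (no a∉X , no b∉X) → inj₂ (inj₁ (∈K⁺ {Y} λ { (inj₁ refl) → ∈K-∪-∉ˡ {X} e∈K (end₁∈ₑ e) a∉X
                                                ; (inj₂ refl) → ∈K-∪-∉ˡ {X} e∈K (end₂∈ₑ e) b∉X }))

  C1 : ∀ E F → ∣ VE n E ∩ VE n F ∣ < suc k → σ M (E ∪ F) ⊆ K n (VE n E) ∪ K n (VE n F)
  C1 E F small {e} e∈σ = case K-∪-cases {VE n E} {VE n F} (K-flat (VE n E ∪ VE n F) (σ-mono (∪⊆K-VE∪VE {E} {F}) e∈σ)) of λ where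
    (inj₁ e∈KE) → ∈-∪⁺ˡ e∈KE
    (inj₂ (inj₁ e∈KF)) → ∈-∪⁺ʳ e∈KF
    (inj₂ (inj₂ (x , y , x∈e , y∈e , x∈ , x∉ , y∈ , y∉))) →
      ⊥-elim (crossing-∉σ (≤-pred small) x∈ x∉ y∈ y∉ x∈e y∈e (∪-mono (⊆K-VE {E}) (⊆K-VE {F})) e∈σ)

  C2 : ∀ E F → Rigid n M E → Rigid n M F → suc k ≤ ∣ VE n E ∩ VE n F ∣ → Rigid n M (E ∪ F)
  C2 E F rigidE rigidF big = ⊆-antisym (K-flat (VE n (E ∪ F)) ∘ σ-mono (⊆K-VE {E ∪ F})) spanned
    where
      KE⊆ : K n (VE n E) ⊆ σ M (E ∪ F)
      KE⊆ e∈ = σ-mono ∈-∪⁺ˡ (subst (_ ∈_) (sym rigidE) e∈)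
      KF⊆ : K n (VE n F) ⊆ σ M (E ∪ F)
      KF⊆ e∈ = σ-mono ∈-∪⁺ʳ (subst (_ ∈_) (sym rigidF) e∈)
      spanned : K n (VE n (E ∪ F)) ⊆ σ M (E ∪ F)
      spanned e∈ = case K-∪-cases {VE n E} {VE n F} (K-mono {VE n (E ∪ F)} (VE-∪⊆ {E} {F}) e∈) of λ where
        (inj₁ e∈KE) → KE⊆ e∈KE
        (inj₂ (inj₁ e∈KF)) → KF⊆ e∈KF
        (inj₂ (inj₂ (x , y , x∈e , y∈e , x∈E , _ , y∈F , y∉E))) →
          let U , U⊆ , ∣U∣≡ = ∃-⊆-of-size _ (suc k) big
              starAt⊆KF : starAt y U ⊆ K n (VE n F)
              starAt⊆KF = K-mono {⁅ y ⁆ ∪ U} (∪-least (⁅x⁆⊆p y∈F) (proj₂ ∘ x∈p∩q⁻ _ _ ∘ U⊆)) ∘ starAt⊆K {y} {U}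
          in ⊆σ⇒σ⊆σ (∪-least KE⊆ (KF⊆ ∘ starAt⊆KF))
          (∈σ-K∪starAt (proj₁ ∘ x∈p∩q⁻ _ _ ∘ U⊆) ∣U∣≡ y∉E x∈E y∈e x∈e)

  isAbstractRigidity : IsAbstractRigidity n M (suc k)
  isAbstractRigidity = C1 , C2

mainTheorem2 : (m n : ℕ) → 0 < m → m + 1 ≤ n → (M : Matroid (N n)) →
    IsAbstractRigidity n M m ⇔
      ((∀ H → Hyperplane M H → ∣ fullVertices n M H ∣ ≤ m ∸ 1)
      × (∀ (v : Fin n) (A : Subset n) → v ∉ A → ∣ A ∣ ≡ m ∸ 1 →
           Hyperplane M (K n (⁅ v ⁆ ∪ A) ∪ K n (∁ ⁅ v ⁆))))
mainTheorem2 (suc k) n _ m+1≤n M = mk⇔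
  (λ AR → let open Necessity k n M AR in fullVertices-bound , λ v A → Δ-hyperplane v A k<n)
  (λ (H1 , H2) → Sufficiency.isAbstractRigidity k n k<n M H1 H2)
  where
    k<n : suc k < n
    k<n = subst (_≤ n) (+-comm (suc k) 1) m+1≤n
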